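{- Let $m\ge 1$. A permutation $\pi\in S_{2m+1}$ is $(m+1)$-toppleable if and only if $\pi_i\le m+i$ for $1\le i\le m$ and $\pi_i\ge i-m$ for $m+1\le i\le 2m+1$; equivalently, $\pi^{ -1}(i)\in\{1,\dots,m+i\}$ for $1\le i\le m+1$ and $\pi^{ -1}(i)\in\{i-m,\dots,2m+1\}$ for $m+2\le i\le 2m+1$. A permutation $\pi\in S_{2m}$ is $(m+1)$-toppleable if and only if $\pi_i\le m+i$ for $1\le i\le m$ and $\pi_i\ge i-m+1$ for $m+1\le i\le 2m$; equivalently, $\pi^{ -1}(i)\in\{1,\dots,m+i-1\}$ for $1\le i\le m$ and $\pi^{ -1}(i)\in\{i-m,\dots,2m\}$ for $m+1\le i\le 2m$.
   Context: For an integer $n\ge 2$ let $L_n=\{ -\lfloor (n+1)/2\rfloor,\dots,\lfloor n/2\rfloor+1\}\subset\mathbb{Z}$; position $0$ is the origin. A toppling move chooses a position $i$ holding at least two chips, chooses two chips $\alpha<\beta$ at $i$, and moves $\alpha$ to $i-1$ and $\beta$ to $i+1$; the toppling process applies such moves (arbitrary choices) until no position holds two or more chips. For $\pi\in S_n$ and $r\in[n+1]$, the initial configuration $\pi^{(r)}$ has, for $j=1,\dots,n$, one chip at position $-\lfloor (n-1)/2\rfloor+j-1$ labeled $\pi_j$ if $\pi_j<r$ and $\pi_j+1$ if $\pi_j\ge r$, plus a chip labeled $r$ at the origin. The final configuration does not depend on the choices and has at most one chip per position; reading chips left to right gives $\mathcal{T}(\pi,r)\in S_{n+1}$. $\pi$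 is $r$-toppleable if $\mathcal{T}(\pi,r)$ is the identity permutation. -}

module Defs where

open import Data.Nat as ℕ using (ℕ; zero; suc; _+_; _∸_; _/_; s≤s)
open import Data.Nat.Properties using (m≤m+n; m<n⇒m<1+n)
open import Data.Integer as ℤ using (ℤ; +_; _-_)
open import Data.Fin as Fin using (Fin; toℕ; punchOut; fromℕ<; _≟_)
open import Data.Fin.Permutation using (Permutation′; _⟨$⟩ʳ_; _⟨$⟩ˡ_)
open import Data.Product using (Σ; _×_; _,_)
open import Relation.Nullary using (yes; no)
open import Relation.Binary.PropositionalEquality using (_≡_)
open import Relation.Binary.Construct.Closure.ReflexiveTransitive using (Star)

-- A configuration of N = n+1 labelled chips.  Chip labels 1..N are
-- represented by Fin N (label = toℕ k + 1); a configuration assigns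
-- to every chip its position in ℤ.
Config : ℕ → Set
Config N = Fin N → ℤ

topple : ∀ {N} → Config N → Fin N → Fin N → Config N
topple c a b k with k ≟ a
... | yes _ = c a - + 1
... | no _ with k ≟ b
...   | yes _ = c b ℤ.+ + 1
...   | no _  = c k

data Step {N : ℕ} : Config N → Config N → Set where
  move : ∀ {c : Config N} (a b : Fin N) → a Fin.< b → c a ≡ c b →
         Step c (topple c a b)

Stable : ∀ {N} → Config N → Set
Stable c = ∀ a b → c a ≡ c b → a ≡ b

ReadsIdentity : ∀ {N} → Config N → Set
ReadsIdentity c = ∀ a b → a Fin.< b → c a ℤ.< c b

-- Initial configuration π^(r), π ∈ S_n, r ∈ [n+1] (r given 0-based as
-- Fin (n+1), i.e. label toℕ r + 1).  The chip j (1-indexed) of π sits at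
-- -⌊(n-1)/2⌋ + j - 1 and carries label π_j if π_j < r, π_j + 1 otherwise;
-- chip r sits at 0.  Equivalently: chip with label k ≠ r comes from the
-- value punchOut (r ≢ k) of π, located at the index π⁻¹ of that value.
initial : ∀ {n} → Permutation′ n → Fin (suc n) → Config (suc n)
initial {n} π r k with r ≟ k
... | yes _  = + 0
... | no r≢k = + toℕ (π ⟨$⟩ˡ punchOut r≢k) - + ((n ∸ 1) / 2)

-- π is r-toppleable: the toppling process from π^(r) ends in a stable
-- configuration that reads as the identity permutation (the final
-- configuration is independent of choices, so "some run" = "every run").
Toppleable : ∀ {n} → Permutation′ n → Fin (suc n) → Set
Toppleable {n} π r =
  Σ (Config (suc n)) λ c →
    Star Step (initial π r) c × Stable c × ReadsIdentity c

-- 1-indexed value π_i at 0-based index j (i = toℕ j + 1)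
val : ∀ {n} → Permutation′ n → Fin n → ℕ
val π j = suc (toℕ (π ⟨$⟩ʳ j))

-- 1-indexed position π⁻¹(i) of the value with 0-based index j
pos : ∀ {n} → Permutation′ n → Fin n → ℕ
pos π j = suc (toℕ (π ⟨$⟩ˡ j))

-- the label m+1 as an element of Fin (2m+2) resp. Fin (2m+1)
rOdd : (m : ℕ) → Fin (suc (suc (m + m)))
rOdd m = fromℕ< (m<n⇒m<1+n (s≤s (m≤m+n m m)))

rEven : (m : ℕ) → Fin (suc (m + m))
rEven m = fromℕ< (s≤s (m≤m+n m m))

module Submission where

-- Toppling is confluent on sparse configurations (no site holds three chips, and an empty site
-- separates any two doubled sites): π^(r) is sparse, sparseness is preserved, and hence every
-- run ends in the same stable configuration.
--
-- A canonical run computes that configuration. In phase k the travelling chip and the k-th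
-- untouched chip topple; the smaller one sinks through the band of V chips below them, and the
-- minimum of this wave settles in slot k. Every chip drifts right by at most one slot per phase,
-- and a settled chip started at most V + 1 slots to the right of where it settles. If each chip
-- with label at most M (labels counted from 0) starts within V + 1 slots of its home, the chip
-- settling in slot k is the one labelled k, so the left part ends sorted; the same run on the
-- mirror image sorts the right part, and uniqueness glues the two halves. Hence π^(r) is
-- toppleable iff −V ≤ π_i − i ≤ M for all i, which is equivalent to each of the stated forms.

open import Defs
open import Data.Nat using (ℕ; suc; _+_; _∸_; _≤_)
open import Data.Fin using (toℕ)
open import Data.Fin.Permutation using (Permutation′)
open import Data.Product using (_×_)
open import Function.Bundles using (_⇔_)

open import Data.Nat using (zero; pred; _<_; _*_; _/_; z≤n; s≤s; _≤?_; _<?_; >-nonZero)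
import Data.Nat.Properties as ℕ
import Data.Nat.DivMod as ℕ
open import Data.Nat.Divisibility using (n∣m*n)
open import Data.Integer as ℤ using (ℤ; +_)
import Data.Integer.Properties as ℤ
open import Data.Integer.Tactic.RingSolver using (solve-∀)
open import Data.Fin as Fin using (Fin; opposite; punchIn; punchOut)
import Data.Fin.Properties as Fin
open import Data.Fin.Permutation using (_⟨$⟩ʳ_; _⟨$⟩ˡ_; inverseˡ; inverseʳ)
open import Data.List using (List; []; _∷_; length; applyDownFrom)
open import Data.List.Properties using (length-applyDownFrom)
open import Data.List.Membership.Propositional using (_∈_)
open import Data.List.Membership.Propositional.Properties using (∈-applyDownFrom⁺; ∈-applyDownFrom⁻)
open import Data.List.Relation.Unary.Any using (here; there)
open import Data.List.Relation.Binary.Permutation.Propositional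
  using (_↭_; prep; swap; ↭-refl; ↭-sym; ↭-trans)
open import Data.List.Relation.Binary.Permutation.Propositional.Properties using (∈-resp-↭)
open import Data.Product using (∃-syntax; ∃₂; _,_; proj₁; proj₂)
open import Data.Sum as Sum using (_⊎_; inj₁; inj₂; [_,_])
open import Data.Empty using (⊥; ⊥-elim)
open import Data.Unit using (⊤; tt)
open import Function using (_∘_)
open import Function.Bundles using (mk⇔; Equivalence)
open import Function.Properties.Equivalence
  using (⇔-setoid) renaming (refl to ⇔-refl; trans to ⇔-trans)
open import Level using (0ℓ)
open import Relation.Nullary using (yes; no; ¬_; contradiction)
open import Relation.Nullary.Decidable using (toSum)
open import Relation.Binary.Definitions using (tri<; tri≈; tri>)
open import Relation.Binary.PropositionalEquality hiding ([_])
open import Relation.Binary.Construct.Closure.ReflexiveTransitive using (Star; ε; _◅_)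
import Relation.Binary.Reasoning.Setoid as SetoidReasoning

module ⇔-Reasoning = SetoidReasoning (⇔-setoid 0ℓ)

private
  variable
    n N : ℕ
    c c′ d e s t : Config N

-- Toppling up to pointwise equality

≗-sym : c ≗ d → d ≗ c
≗-sym c≗d k = sym (c≗d k)

≗-trans : c ≗ c′ → c′ ≗ d → c ≗ d
≗-trans c≗c′ c′≗d k = trans (c≗c′ k) (c′≗d k)

module _ (c : Config N) (a b : Fin N) where

  topple-lower : topple c a b a ≡ c a ℤ.- + 1
  topple-lower with a Fin.≟ a
  ... | yes _   = refl
  ... | no a≢a = contradiction refl a≢a

  topple-upper : a ≢ b → topple c a b b ≡ c b ℤ.+ + 1
  topple-upper a≢b with b Fin.≟ a
  ... | yes b≡a = contradiction (sym b≡a) a≢b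
  ... | no _ with b Fin.≟ b
  ...   | yes _   = refl
  ...   | no b≢b = contradiction refl b≢b

  topple-other : ∀ {k} → k ≢ a → k ≢ b → topple c a b k ≡ c k
  topple-other {k} k≢a k≢b with k Fin.≟ a
  ... | yes k≡a = contradiction k≡a k≢a
  ... | no _ with k Fin.≟ b
  ...   | yes k≡b = contradiction k≡b k≢b
  ...   | no _    = refl

topple-cong : ∀ a b → c ≗ d → topple c a b ≗ topple d a b
topple-cong a b c≗d k with k Fin.≟ a
... | yes _ = cong (ℤ._- + 1) (c≗d a)
... | no _ with k Fin.≟ b
...   | yes _ = cong (ℤ._+ + 1) (c≗d b)
...   | no _  = c≗d k

topple-comm : ∀ {a b a′ b′} → a ≢ b → a′ ≢ b′ →
              a ≢ a′ → a ≢ b′ → b ≢ a′ → b ≢ b′ →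
              topple (topple c a b) a′ b′ ≗ topple (topple c a′ b′) a b
topple-comm {c = c} {a} {b} {a′} {b′} a≢b a′≢b′ a≢a′ a≢b′ b≢a′ b≢b′ k
  with toSum (k Fin.≟ a) | toSum (k Fin.≟ b) | toSum (k Fin.≟ a′) | toSum (k Fin.≟ b′)
... | inj₁ refl | _ | _ | _ = begin
  topple (topple c a b) a′ b′ a   ≡⟨ topple-other _ a′ b′ a≢a′ a≢b′ ⟩
  topple c a b a                  ≡⟨ topple-lower c a b ⟩
  c a ℤ.- + 1                     ≡⟨ cong (ℤ._- + 1) (topple-other c a′ b′ a≢a′ a≢b′) ⟨
  topple c a′ b′ a ℤ.- + 1        ≡⟨ topple-lower _ a b ⟨
  topple (topple c a′ b′) a b a   ∎
  where open ≡-Reasoning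
... | inj₂ _ | inj₁ refl | _ | _ = begin
  topple (topple c a b) a′ b′ b   ≡⟨ topple-other _ a′ b′ b≢a′ b≢b′ ⟩
  topple c a b b                  ≡⟨ topple-upper c a b a≢b ⟩
  c b ℤ.+ + 1                     ≡⟨ cong (ℤ._+ + 1) (topple-other c a′ b′ b≢a′ b≢b′) ⟨
  topple c a′ b′ b ℤ.+ + 1        ≡⟨ topple-upper _ a b a≢b ⟨
  topple (topple c a′ b′) a b b   ∎
  where open ≡-Reasoning
... | inj₂ k≢a | inj₂ k≢b | inj₁ refl | _ = begin
  topple (topple c a b) a′ b′ a′  ≡⟨ topple-lower _ a′ b′ ⟩
  topple c a b a′ ℤ.- + 1         ≡⟨ cong (ℤ._- + 1) (topple-other c a b k≢a k≢b) ⟩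
  c a′ ℤ.- + 1                    ≡⟨ topple-lower c a′ b′ ⟨
  topple c a′ b′ a′               ≡⟨ topple-other _ a b k≢a k≢b ⟨
  topple (topple c a′ b′) a b a′  ∎
  where open ≡-Reasoning
... | inj₂ k≢a | inj₂ k≢b | inj₂ _ | inj₁ refl = begin
  topple (topple c a b) a′ b′ b′  ≡⟨ topple-upper _ a′ b′ a′≢b′ ⟩
  topple c a b b′ ℤ.+ + 1         ≡⟨ cong (ℤ._+ + 1) (topple-other c a b k≢a k≢b) ⟩
  c b′ ℤ.+ + 1                    ≡⟨ topple-upper c a′ b′ a′≢b′ ⟨
  topple c a′ b′ b′               ≡⟨ topple-other _ a b k≢a k≢b ⟨
  topple (topple c a′ b′) a b b′  ∎
  where open ≡-Reasoning
... | inj₂ k≢a | inj₂ k≢b | inj₂ k≢a′ | inj₂ k≢b′ = begin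
  topple (topple c a b) a′ b′ k   ≡⟨ topple-other _ a′ b′ k≢a′ k≢b′ ⟩
  topple c a b k                  ≡⟨ topple-other c a b k≢a k≢b ⟩
  c k                             ≡⟨ topple-other c a′ b′ k≢a′ k≢b′ ⟨
  topple c a′ b′ k                ≡⟨ topple-other _ a b k≢a k≢b ⟨
  topple (topple c a′ b′) a b k   ∎
  where open ≡-Reasoning

infix 4 _⟶_ _⟶*_
infixr 5 _◅_ _◅◅_

data _⟶_ {N} (c d : Config N) : Set where
  topples : ∀ a b → a Fin.< b → c a ≡ c b → topple c a b ≗ d → c ⟶ d

data _⟶*_ {N} : Config N → Config N → Set where
  done : c ≗ d → c ⟶* d
  _◅_  : c ⟶ c′ → c′ ⟶* d → c ⟶* d

⟶-respˡ : c ≗ c′ → c ⟶ d → c′ ⟶ d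
⟶-respˡ c≗c′ (topples a b a<b ca≡cb t) =
  topples a b a<b (trans (sym (c≗c′ a)) (trans ca≡cb (c≗c′ b)))
    (≗-trans (topple-cong a b (≗-sym c≗c′)) t)

⟶*-respˡ : c ≗ c′ → c ⟶* d → c′ ⟶* d
⟶*-respˡ c≗c′ (done c≗d) = done (≗-trans (≗-sym c≗c′) c≗d)
⟶*-respˡ c≗c′ (s ◅ r)    = ⟶-respˡ c≗c′ s ◅ r

⟶*-respʳ : c ⟶* d → d ≗ e → c ⟶* e
⟶*-respʳ (done c≗d) d≗e = done (≗-trans c≗d d≗e)
⟶*-respʳ (s ◅ r)    d≗e = s ◅ ⟶*-respʳ r d≗e

_◅◅_ : c ⟶* c′ → c′ ⟶* d → c ⟶* d
done c≗c′ ◅◅ r  = ⟶*-respˡ (≗-sym c≗c′) r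
(s ◅ r₁) ◅◅ r₂ = s ◅ (r₁ ◅◅ r₂)

Step⇒⟶ : Step c d → c ⟶ d
Step⇒⟶ (move a b a<b ca≡cb) = topples a b a<b ca≡cb (λ _ → refl)

Star⇒⟶* : Star Step c d → c ⟶* d
Star⇒⟶* ε       = done (λ _ → refl)
Star⇒⟶* (s ◅ r) = Step⇒⟶ s ◅ Star⇒⟶* r

-- The extra c ≗ c′ keeps the recursion structural.
⟶*⇒Star : c ≗ c′ → c ⟶* d → ∃[ d′ ] Star Step c′ d′ × d′ ≗ d
⟶*⇒Star c≗c′ (done c≗d) = _ , ε , ≗-trans (≗-sym c≗c′) c≗d
⟶*⇒Star c≗c′ (topples a b a<b ca≡cb t ◅ r)
  with ⟶*⇒Star (≗-trans (≗-sym t) (topple-cong a b c≗c′)) r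
... | d′ , r′ , d′≗d =
  d′ , move a b a<b (trans (sym (c≗c′ a)) (trans ca≡cb (c≗c′ b))) ◅ r′ , d′≗d

Stable-resp : c ≗ d → Stable c → Stable d
Stable-resp c≗d stable a b da≡db = stable a b (trans (c≗d a) (trans da≡db (sym (c≗d b))))

ReadsIdentity-resp : c ≗ d → ReadsIdentity c → ReadsIdentity d
ReadsIdentity-resp c≗d sorted a b a<b = subst₂ ℤ._<_ (c≗d a) (c≗d b) (sorted a b a<b)

Stable⇒irreducible : Stable c → ¬ (c ⟶ d)
Stable⇒irreducible stable (topples a b a<b ca≡cb _) = Fin.<⇒≢ a<b (stable a b ca≡cb)

-- Confluence

i-1+1≡i : ∀ i → i ℤ.- + 1 ℤ.+ + 1 ≡ i
i-1+1≡i = solve-∀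

i+1-1≡i : ∀ i → i ℤ.+ + 1 ℤ.- + 1 ≡ i
i+1-1≡i = solve-∀

neg-[i+1] : ∀ i → ℤ.- (i ℤ.+ + 1) ≡ ℤ.- i ℤ.- + 1
neg-[i+1] = solve-∀

neg-[i-1] : ∀ i → ℤ.- (i ℤ.- + 1) ≡ ℤ.- i ℤ.+ + 1
neg-[i-1] = solve-∀

i<i+1 : ∀ i → i ℤ.< i ℤ.+ + 1
i<i+1 i = ℤ.suc[i]≤j⇒i<j (ℤ.≤-reflexive (ℤ.+-comm (+ 1) i))

i-1<i : ∀ i → i ℤ.- + 1 ℤ.< i
i-1<i i = subst (i ℤ.- + 1 ℤ.<_) (i-1+1≡i i) (i<i+1 (i ℤ.- + 1))

nothing-between : ∀ {i j} → i ℤ.< j → j ℤ.< i ℤ.+ + 1 → ⊥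
nothing-between {i} {j} i<j j<i+1 =
  ℤ.<-irrefl refl (ℤ.<-≤-trans j<i+1 (subst (ℤ._≤ j) (ℤ.+-comm (+ 1) i) (ℤ.i<j⇒suc[i]≤j i<j)))

<-tighten : ∀ {i j} → j ℤ.< i ℤ.+ + 1 → j ≢ i → j ℤ.< i
<-tighten {i} {j} j<i+1 j≢i with ℤ.<-cmp j i
... | tri< j<i _ _ = j<i
... | tri≈ _ j≡i _ = contradiction j≡i j≢i
... | tri> _ _ i<j = ⊥-elim (nothing-between i<j j<i+1)

>-tighten : ∀ {i j} → i ℤ.- + 1 ℤ.< j → j ≢ i → i ℤ.< j
>-tighten {i} {j} i-1<j j≢i with ℤ.<-cmp j i
... | tri< j<i _ _ = ⊥-elim (nothing-between i-1<j (subst (j ℤ.<_) (sym (i-1+1≡i i)) j<i))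
... | tri≈ _ j≡i _ = contradiction j≡i j≢i
... | tri> _ _ i<j = i<j

Vacant : Config N → ℤ → Set
Vacant c q = ∀ k → c k ≢ q

Doubled : Config N → ℤ → Set
Doubled c q = ∃₂ λ x y → x ≢ y × c x ≡ q × c y ≡ q

AtMostTwo : Config N → Set
AtMostTwo c = ∀ x y z → x ≢ y → x ≢ z → y ≢ z → c x ≡ c y → c x ≡ c z → ⊥

Separated : Config N → Set
Separated c = ∀ {q₁ q₂} → Doubled c q₁ → Doubled c q₂ → q₁ ℤ.< q₂ →
              ∃[ s ] q₁ ℤ.< s × s ℤ.< q₂ × Vacant c s

Sparse : Config N → Set
Sparse c = AtMostTwo c × Separated c

Sparse-resp : c ≗ d → Sparse c → Sparse d
Sparse-resp c≗d (atMostTwo , separated) = atMostTwo′ , separated′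
  where
  from : ∀ {q} → Doubled _ q → Doubled _ q
  from (x , y , x≢y , dx , dy) = x , y , x≢y , trans (c≗d x) dx , trans (c≗d y) dy
  atMostTwo′ : AtMostTwo _
  atMostTwo′ x y z x≢y x≢z y≢z xy xz =
    atMostTwo x y z x≢y x≢z y≢z (trans (c≗d x) (trans xy (sym (c≗d y))))
                                (trans (c≗d x) (trans xz (sym (c≗d z))))
  separated′ : Separated _
  separated′ d₁ d₂ p<q with separated (from d₁) (from d₂) p<q
  ... | s , p<s , s<q , vacant = s , p<s , s<q , λ k dk → vacant k (trans (c≗d k) dk)

module Toppled {N} (c : Config N) {a b : Fin N} (a≢b : a ≢ b) (ca≡cb : c a ≡ c b)
               (atMostTwo : AtMostTwo c) (separated : Separated c) where

  private
    p : ℤ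
    p = c a

    c₁ : Config N
    c₁ = topple c a b

  c₁a : c₁ a ≡ p ℤ.- + 1
  c₁a = topple-lower c a b

  c₁b : c₁ b ≡ p ℤ.+ + 1
  c₁b = trans (topple-upper c a b a≢b) (cong (ℤ._+ + 1) (sym ca≡cb))

  c₁-other : ∀ {k} → k ≢ a → k ≢ b → c k ≡ c₁ k
  c₁-other k≢a k≢b = sym (topple-other c a b k≢a k≢b)

  p-1≢p+1 : p ℤ.- + 1 ≢ p ℤ.+ + 1
  p-1≢p+1 = ℤ.<⇒≢ (ℤ.<-trans (i-1<i p) (i<i+1 p))

  below≢b : ∀ {k} → c₁ k ≡ p ℤ.- + 1 → k ≢ b
  below≢b c₁k refl = p-1≢p+1 (trans (sym c₁k) c₁b)

  above≢a : ∀ {k} → c₁ k ≡ p ℤ.+ + 1 → k ≢ a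
  above≢a c₁k refl = p-1≢p+1 (trans (sym c₁a) c₁k)

  unmoved-below : ∀ {k} → k ≢ a → c₁ k ≡ p ℤ.- + 1 → c k ≡ p ℤ.- + 1
  unmoved-below k≢a c₁k = trans (c₁-other k≢a (below≢b c₁k)) c₁k

  unmoved-above : ∀ {k} → k ≢ b → c₁ k ≡ p ℤ.+ + 1 → c k ≡ p ℤ.+ + 1
  unmoved-above k≢b c₁k = trans (c₁-other (above≢a c₁k) k≢b) c₁k

  doubled-p : Doubled c p
  doubled-p = a , b , a≢b , refl , sym ca≡cb

  ¬doubled-below : ¬ Doubled c (p ℤ.- + 1)
  ¬doubled-below d with separated d doubled-p (i-1<i p)
  ... | _ , p-1<s , s<p , _ = nothing-between p-1<s (subst (_ ℤ.<_) (sym (i-1+1≡i p)) s<p)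

  ¬doubled-above : ¬ Doubled c (p ℤ.+ + 1)
  ¬doubled-above d with separated doubled-p d (i<i+1 p)
  ... | _ , p<s , s<p+1 , _ = nothing-between p<s s<p+1

  vacant-p : Vacant c₁ p
  vacant-p k c₁k with toSum (k Fin.≟ a) | toSum (k Fin.≟ b)
  ... | inj₁ refl | _ = ℤ.<⇒≢ (i-1<i p) (trans (sym c₁a) c₁k)
  ... | inj₂ _ | inj₁ refl = ℤ.<⇒≢ (i<i+1 p) (sym (trans (sym c₁b) c₁k))
  ... | inj₂ k≢a | inj₂ k≢b =
    atMostTwo a b k a≢b (≢-sym k≢a) (≢-sym k≢b) ca≡cb (sym (trans (c₁-other k≢a k≢b) c₁k))

  via-p : ∀ {q₁ q₂} → q₁ ℤ.< p → p ℤ.< q₂ → ∃[ s ] q₁ ℤ.< s × s ℤ.< q₂ × Vacant c₁ s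
  via-p q₁<p p<q₂ = p , q₁<p , p<q₂ , vacant-p

  vacant-kept : ∀ {s} → Vacant c s → s ≢ p ℤ.- + 1 → s ≢ p ℤ.+ + 1 → Vacant c₁ s
  vacant-kept vacant s≢p-1 s≢p+1 k c₁k with toSum (k Fin.≟ a) | toSum (k Fin.≟ b)
  ... | inj₁ refl | _ = s≢p-1 (trans (sym c₁k) c₁a)
  ... | inj₂ _ | inj₁ refl = s≢p+1 (trans (sym c₁k) c₁b)
  ... | inj₂ k≢a | inj₂ k≢b = vacant k (trans (c₁-other k≢a k≢b) c₁k)

  pair-below : ∀ {u v} → u ≢ v → u ≢ a → v ≢ a →
               c₁ u ≡ p ℤ.- + 1 → c₁ v ≡ p ℤ.- + 1 → ⊥
  pair-below u≢v u≢a v≢a c₁u c₁v =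
    ¬doubled-below (_ , _ , u≢v , unmoved-below u≢a c₁u , unmoved-below v≢a c₁v)

  pair-above : ∀ {u v} → u ≢ v → u ≢ b → v ≢ b →
               c₁ u ≡ p ℤ.+ + 1 → c₁ v ≡ p ℤ.+ + 1 → ⊥
  pair-above u≢v u≢b v≢b c₁u c₁v =
    ¬doubled-above (_ , _ , u≢v , unmoved-above u≢b c₁u , unmoved-above v≢b c₁v)

  atMostTwo₁ : AtMostTwo c₁
  atMostTwo₁ x y z x≢y x≢z y≢z xy xz with toSum (x Fin.≟ a) | toSum (x Fin.≟ b)
  ... | inj₁ refl | _ =
    pair-below y≢z (≢-sym x≢y) (≢-sym x≢z) (trans (sym xy) c₁a) (trans (sym xz) c₁a)
  ... | inj₂ _ | inj₁ refl =
    pair-above y≢z (≢-sym x≢y) (≢-sym x≢z) (trans (sym xy) c₁b) (trans (sym xz) c₁b)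
  ... | inj₂ x≢a | inj₂ x≢b with toSum (y Fin.≟ a) | toSum (y Fin.≟ b)
  ...   | inj₁ refl | _ =
    pair-below x≢z x≢a (≢-sym y≢z) (trans xy c₁a) (trans (sym xz) (trans xy c₁a))
  ...   | inj₂ _ | inj₁ refl =
    pair-above x≢z x≢b (≢-sym y≢z) (trans xy c₁b) (trans (sym xz) (trans xy c₁b))
  ...   | inj₂ y≢a | inj₂ y≢b with toSum (z Fin.≟ a) | toSum (z Fin.≟ b)
  ...     | inj₁ refl | _ =
    pair-below x≢y x≢a y≢a (trans xz c₁a) (trans (sym xy) (trans xz c₁a))
  ...     | inj₂ _ | inj₁ refl =
    pair-above x≢y x≢b y≢b (trans xz c₁b) (trans (sym xy) (trans xz c₁b))
  ...     | inj₂ z≢a | inj₂ z≢b = atMostTwo x y z x≢y x≢z y≢z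
    (trans (c₁-other x≢a x≢b) (trans xy (sym (c₁-other y≢a y≢b))))
    (trans (c₁-other x≢a x≢b) (trans xz (sym (c₁-other z≢a z≢b))))

  data Doubled₁ (q : ℤ) : Set where
    old   : q ≢ p → Doubled c q → Doubled₁ q
    below : q ≡ p ℤ.- + 1 → ∃[ y ] c y ≡ p ℤ.- + 1 → Doubled₁ q
    above : q ≡ p ℤ.+ + 1 → ∃[ y ] c y ≡ p ℤ.+ + 1 → Doubled₁ q

  classify : ∀ {q} → Doubled c₁ q → Doubled₁ q
  classify (x , y , x≢y , c₁x , c₁y) with toSum (x Fin.≟ a) | toSum (x Fin.≟ b)
  ... | inj₁ refl | _ = below (trans (sym c₁x) c₁a)
    (y , unmoved-below (≢-sym x≢y) (trans c₁y (trans (sym c₁x) c₁a)))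
  ... | inj₂ _ | inj₁ refl = above (trans (sym c₁x) c₁b)
    (y , unmoved-above (≢-sym x≢y) (trans c₁y (trans (sym c₁x) c₁b)))
  ... | inj₂ x≢a | inj₂ x≢b with toSum (y Fin.≟ a) | toSum (y Fin.≟ b)
  ...   | inj₁ refl | _ = below (trans (sym c₁y) c₁a)
    (x , unmoved-below x≢a (trans c₁x (trans (sym c₁y) c₁a)))
  ...   | inj₂ _ | inj₁ refl = above (trans (sym c₁y) c₁b)
    (x , unmoved-above x≢b (trans c₁x (trans (sym c₁y) c₁b)))
  ...   | inj₂ y≢a | inj₂ y≢b = old (λ q≡p → vacant-p x (trans c₁x q≡p))
    (x , y , x≢y , trans (c₁-other x≢a x≢b) c₁x , trans (c₁-other y≢a y≢b) c₁y)

  separated₁ : Separated c₁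
  separated₁ d₁ d₂ q₁<q₂ with classify d₁ | classify d₂
  ... | old q₁≢p e₁ | old q₂≢p e₂ with separated e₁ e₂ q₁<q₂
  ...   | s , q₁<s , s<q₂ , vacant with s ℤ.≟ p ℤ.- + 1 | s ℤ.≟ p ℤ.+ + 1
  ...     | yes refl | _ = via-p (ℤ.<-trans q₁<s (i-1<i p)) (>-tighten s<q₂ q₂≢p)
  ...     | no _ | yes refl = via-p (<-tighten q₁<s q₁≢p) (ℤ.<-trans (i<i+1 p) s<q₂)
  ...     | no s≢p-1 | no s≢p+1 = s , q₁<s , s<q₂ , vacant-kept vacant s≢p-1 s≢p+1
  separated₁ d₁ d₂ q₁<q₂ | old q₁≢p e₁ | below refl (y , cy)
    with separated e₁ doubled-p (ℤ.<-trans q₁<q₂ (i-1<i p))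
  ... | s , q₁<s , s<p , vacant =
    s , q₁<s , <-tighten (subst (s ℤ.<_) (sym (i-1+1≡i p)) s<p) s≢p-1 ,
    vacant-kept vacant s≢p-1 (ℤ.<⇒≢ (ℤ.<-trans s<p (i<i+1 p)))
    where
    s≢p-1 : s ≢ p ℤ.- + 1
    s≢p-1 s≡p-1 = vacant y (trans cy (sym s≡p-1))
  separated₁ d₁ d₂ q₁<q₂ | old q₁≢p _ | above refl _ = via-p (<-tighten q₁<q₂ q₁≢p) (i<i+1 p)
  separated₁ d₁ d₂ q₁<q₂ | below refl _ | old q₂≢p _ = via-p (i-1<i p) (>-tighten q₁<q₂ q₂≢p)
  separated₁ d₁ d₂ q₁<q₂ | below refl _ | below refl _ = ⊥-elim (ℤ.<-irrefl refl q₁<q₂)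
  separated₁ d₁ d₂ q₁<q₂ | below refl _ | above refl _ = via-p (i-1<i p) (i<i+1 p)
  separated₁ d₁ d₂ q₁<q₂ | above refl (y , cy) | old q₂≢p e₂
    with separated doubled-p e₂ (ℤ.<-trans (i<i+1 p) q₁<q₂)
  ... | s , p<s , s<q₂ , vacant =
    s , >-tighten (subst (ℤ._< s) (sym (i+1-1≡i p)) p<s) s≢p+1 , s<q₂ ,
    vacant-kept vacant (≢-sym (ℤ.<⇒≢ (ℤ.<-trans (i-1<i p) p<s))) s≢p+1
    where
    s≢p+1 : s ≢ p ℤ.+ + 1
    s≢p+1 s≡p+1 = vacant y (trans cy (sym s≡p+1))
  separated₁ d₁ d₂ q₁<q₂ | above refl _ | below refl _ =
    ⊥-elim (ℤ.<-asym q₁<q₂ (ℤ.<-trans (i-1<i p) (i<i+1 p)))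
  separated₁ d₁ d₂ q₁<q₂ | above refl _ | above refl _ = ⊥-elim (ℤ.<-irrefl refl q₁<q₂)

  sparse₁ : Sparse c₁
  sparse₁ = atMostTwo₁ , separated₁

Sparse-⟶ : Sparse c → c ⟶ d → Sparse d
Sparse-⟶ (atMostTwo , separated) (topples a b a<b ca≡cb t) =
  Sparse-resp t (Toppled.sparse₁ _ (Fin.<⇒≢ a<b) ca≡cb atMostTwo separated)

diamond : Sparse c → c ⟶ d → c ⟶ e → d ≗ e ⊎ ∃[ f ] d ⟶ f × e ⟶ f
diamond {c = c} {d} {e} (atMostTwo , _)
        (topples a b a<b ca≡cb t) (topples a′ b′ a′<b′ ca′≡cb′ t′)
  with toSum (a Fin.≟ a′) | toSum (b Fin.≟ b′)
... | inj₁ refl | inj₁ refl = inj₁ (≗-trans (≗-sym t) t′)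
... | inj₁ refl | inj₂ b≢b′ =
  ⊥-elim (atMostTwo a b b′ (Fin.<⇒≢ a<b) (Fin.<⇒≢ a′<b′) b≢b′ ca≡cb ca′≡cb′)
... | inj₂ a≢a′ | inj₁ refl =
  ⊥-elim (atMostTwo b a a′ (≢-sym (Fin.<⇒≢ a<b)) (≢-sym (Fin.<⇒≢ a′<b′)) a≢a′
                    (sym ca≡cb) (sym ca′≡cb′))
... | inj₂ a≢a′ | inj₂ b≢b′ with toSum (a Fin.≟ b′) | toSum (b Fin.≟ a′)
...   | inj₁ refl | _ =
  ⊥-elim (atMostTwo a′ a b (Fin.<⇒≢ a′<b′) (Fin.<⇒≢ (Fin.<-trans a′<b′ a<b)) (Fin.<⇒≢ a<b)
                    ca′≡cb′ (trans ca′≡cb′ ca≡cb))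
...   | inj₂ _ | inj₁ refl =
  ⊥-elim (atMostTwo a b b′ (Fin.<⇒≢ a<b) (Fin.<⇒≢ (Fin.<-trans a<b a′<b′)) (Fin.<⇒≢ a′<b′)
                    ca≡cb (trans ca≡cb ca′≡cb′))
...   | inj₂ a≢b′ | inj₂ b≢a′ = inj₂ (topple (topple c a b) a′ b′ , d⟶f , e⟶f)
  where
  d⟶f : d ⟶ topple (topple c a b) a′ b′
  d⟶f = ⟶-respˡ t (topples a′ b′ a′<b′
          (trans (topple-other c a b (≢-sym a≢a′) (≢-sym b≢a′))
          (trans ca′≡cb′ (sym (topple-other c a b (≢-sym a≢b′) (≢-sym b≢b′)))))
          (λ _ → refl))
  e⟶f : e ⟶ topple (topple c a b) a′ b′
  e⟶f = ⟶-respˡ t′ (topples a b a<b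
          (trans (topple-other c a′ b′ a≢a′ a≢b′)
          (trans ca≡cb (sym (topple-other c a′ b′ b≢a′ b≢b′))))
          (≗-sym (topple-comm (Fin.<⇒≢ a<b) (Fin.<⇒≢ a′<b′) a≢a′ a≢b′ b≢a′ b≢b′)))

⟶*-after-⟶ : Sparse c → c ⟶* s → Stable s → c ⟶ d → d ⟶* s
⟶*-after-⟶ _ (done c≗s) stable c⟶d =
  ⊥-elim (Stable⇒irreducible (Stable-resp (≗-sym c≗s) stable) c⟶d)
⟶*-after-⟶ sparse (c⟶c₁ ◅ r) stable c⟶d with diamond sparse c⟶c₁ c⟶d
... | inj₁ c₁≗d = ⟶*-respˡ c₁≗d r
... | inj₂ (_ , c₁⟶f , d⟶f) = d⟶f ◅ ⟶*-after-⟶ (Sparse-⟶ sparse c⟶c₁) r stable c₁⟶f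

stable-unique : Sparse c → c ⟶* s → Stable s → c ⟶* t → Stable t → s ≗ t
stable-unique _ (done c≗s) _ (done c≗t) _ = ≗-trans (≗-sym c≗s) c≗t
stable-unique _ (c⟶c₁ ◅ _) _ (done c≗t) stable-t =
  ⊥-elim (Stable⇒irreducible (Stable-resp (≗-sym c≗t) stable-t) c⟶c₁)
stable-unique sparse r stable-s (c⟶c₁ ◅ r′) stable-t =
  stable-unique (Sparse-⟶ sparse c⟶c₁) (⟶*-after-⟶ sparse r stable-s c⟶c₁) stable-s r′ stable-t

-- Mirror symmetry

mirror : Config N → Config N
mirror c k = ℤ.- c (opposite k)

opposite-injective : ∀ {x y : Fin N} → opposite x ≡ opposite y → x ≡ y
opposite-injective {x = x} {y} eq =
  trans (sym (Fin.opposite-involutive x)) (trans (cong opposite eq) (Fin.opposite-involutive y))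

opposite-reverses-< : ∀ {a b : Fin N} → a Fin.< b → opposite b Fin.< opposite a
opposite-reverses-< {N} {a} {b} a<b =
  subst₂ _<_ (sym (Fin.opposite-prop b)) (sym (Fin.opposite-prop a))
         (ℕ.∸-monoʳ-< (s≤s a<b) (Fin.toℕ<n b))

mirror-cong : c ≗ d → mirror c ≗ mirror d
mirror-cong c≗d k = cong ℤ.-_ (c≗d (opposite k))

mirror-involutive : (c : Config N) → mirror (mirror c) ≗ c
mirror-involutive c k = trans (ℤ.neg-involutive _) (cong c (Fin.opposite-involutive k))

mirror-topple : (c : Config N) {a b : Fin N} → a ≢ b →
                topple (mirror c) (opposite b) (opposite a) ≗ mirror (topple c a b)
mirror-topple c {a} {b} a≢b k
  with toSum (k Fin.≟ opposite b) | toSum (k Fin.≟ opposite a)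
... | inj₁ refl | _ = begin
  topple (mirror c) (opposite b) (opposite a) (opposite b)
    ≡⟨ topple-lower (mirror c) _ _ ⟩
  ℤ.- c (opposite (opposite b)) ℤ.- + 1
    ≡⟨ cong (λ x → ℤ.- c x ℤ.- + 1) (Fin.opposite-involutive b) ⟩
  ℤ.- c b ℤ.- + 1
    ≡⟨ neg-[i+1] (c b) ⟨
  ℤ.- (c b ℤ.+ + 1)
    ≡⟨ cong ℤ.-_ (topple-upper c a b a≢b) ⟨
  ℤ.- topple c a b b
    ≡⟨ cong (ℤ.-_ ∘ topple c a b) (Fin.opposite-involutive b) ⟨
  mirror (topple c a b) (opposite b) ∎
  where open ≡-Reasoning
... | inj₂ _ | inj₁ refl = begin
  topple (mirror c) (opposite b) (opposite a) (opposite a)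
    ≡⟨ topple-upper (mirror c) _ _ (a≢b ∘ opposite-injective ∘ sym) ⟩
  ℤ.- c (opposite (opposite a)) ℤ.+ + 1
    ≡⟨ cong (λ x → ℤ.- c x ℤ.+ + 1) (Fin.opposite-involutive a) ⟩
  ℤ.- c a ℤ.+ + 1
    ≡⟨ neg-[i-1] (c a) ⟨
  ℤ.- (c a ℤ.- + 1)
    ≡⟨ cong ℤ.-_ (topple-lower c a b) ⟨
  ℤ.- topple c a b a
    ≡⟨ cong (ℤ.-_ ∘ topple c a b) (Fin.opposite-involutive a) ⟨
  mirror (topple c a b) (opposite a) ∎
  where open ≡-Reasoning
... | inj₂ k≢b̄ | inj₂ k≢ā = trans (topple-other (mirror c) _ _ k≢b̄ k≢ā)
  (cong ℤ.-_ (sym (topple-other c a b (k≢ā ∘ opposite-flip) (k≢b̄ ∘ opposite-flip))))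
  where
  opposite-flip : ∀ {x} → opposite k ≡ x → k ≡ opposite x
  opposite-flip refl = sym (Fin.opposite-involutive k)

mirror-⟶ : c ⟶ d → mirror c ⟶ mirror d
mirror-⟶ {c = c} (topples a b a<b ca≡cb t) =
  topples (opposite b) (opposite a) (opposite-reverses-< a<b)
    (cong ℤ.-_ (trans (cong c (Fin.opposite-involutive b))
               (trans (sym ca≡cb) (sym (cong c (Fin.opposite-involutive a))))))
    (≗-trans (mirror-topple c (Fin.<⇒≢ a<b)) (mirror-cong t))

mirror-⟶* : c ⟶* d → mirror c ⟶* mirror d
mirror-⟶* (done c≗d) = done (mirror-cong c≗d)
mirror-⟶* (s ◅ r)    = mirror-⟶ s ◅ mirror-⟶* r

Stable-mirror : Stable c → Stable (mirror c)
Stable-mirror stable a b eq = opposite-injective (stable _ _ (ℤ.neg-injective eq))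

-- Waves

module _ {N : ℕ} where

  infixl 7 _⊓_ _⊔_

  _⊓_ : Fin N → Fin N → Fin N
  x ⊓ y with x Fin.<? y
  ... | yes _ = x
  ... | no _  = y

  _⊔_ : Fin N → Fin N → Fin N
  x ⊔ y with x Fin.<? y
  ... | yes _ = y
  ... | no _  = x

  ⊓-sel : ∀ x y → x ⊓ y ≡ x ⊎ x ⊓ y ≡ y
  ⊓-sel x y with x Fin.<? y
  ... | yes _ = inj₁ refl
  ... | no _  = inj₂ refl

  ⊔-sel : ∀ x y → x ⊔ y ≡ x ⊎ x ⊔ y ≡ y
  ⊔-sel x y with x Fin.<? y
  ... | yes _ = inj₂ refl
  ... | no _  = inj₁ refl

  ⊓-⊔-cover : ∀ {x y z} → z ≡ x ⊎ z ≡ y → z ≡ x ⊓ y ⊎ z ≡ x ⊔ y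
  ⊓-⊔-cover {x} {y} z≡x∨y with x Fin.<? y
  ... | yes _ = z≡x∨y
  ... | no _  = Sum.swap z≡x∨y

  ⊓<⊔ : ∀ {x y} → x ≢ y → x ⊓ y Fin.< x ⊔ y
  ⊓<⊔ {x} {y} x≢y with x Fin.<? y
  ... | yes x<y = x<y
  ... | no x≮y  = Fin.≤∧≢⇒< (ℕ.≮⇒≥ x≮y) (x≢y ∘ sym)

  ⊓-≤ˡ : ∀ x y → x ⊓ y Fin.≤ x
  ⊓-≤ˡ x y with x Fin.<? y
  ... | yes _   = ℕ.≤-refl
  ... | no x≮y = ℕ.≮⇒≥ x≮y

  ⊓-≤ʳ : ∀ x y → x ⊓ y Fin.≤ y
  ⊓-≤ʳ x y with x Fin.<? y
  ... | yes x<y = ℕ.<⇒≤ x<y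
  ... | no _    = ℕ.≤-refl

  x<y⇒x⊓y≡x : ∀ {x y} → x Fin.< y → x ⊓ y ≡ x
  x<y⇒x⊓y≡x {x} {y} x<y with x Fin.<? y
  ... | yes _   = refl
  ... | no x≮y = contradiction x<y x≮y

  y<x⇒x⊓y≡y : ∀ {x y} → y Fin.< x → x ⊓ y ≡ y
  y<x⇒x⊓y≡y {x} {y} y<x with x Fin.<? y
  ... | yes x<y = contradiction x<y (Fin.<-asym y<x)
  ... | no _    = refl

  ⊔⊓-↭ : ∀ x y (L : List (Fin N)) → x ∷ y ∷ L ↭ x ⊔ y ∷ x ⊓ y ∷ L
  ⊔⊓-↭ x y L with x Fin.<? y
  ... | yes _ = swap x y ↭-refl
  ... | no _  = ↭-refl

  -- A chip arriving on top of a laid list sinks through it: at each site the smaller chip moves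
  -- on down and the larger one up, so `deposit` leaves at the bottom and `raised` is pushed up.
  raised : Fin N → List (Fin N) → List (Fin N)
  raised x []       = []
  raised x (y ∷ ys) = x ⊔ y ∷ raised (x ⊓ y) ys

  deposit : Fin N → List (Fin N) → Fin N
  deposit x []       = x
  deposit x (y ∷ ys) = deposit (x ⊓ y) ys

  length-raised : ∀ x L → length (raised x L) ≡ length L
  length-raised x []       = refl
  length-raised x (y ∷ ys) = cong suc (length-raised (x ⊓ y) ys)

  deposit-raised-↭ : ∀ x L → x ∷ L ↭ deposit x L ∷ raised x L
  deposit-raised-↭ x []       = ↭-refl
  deposit-raised-↭ x (y ∷ ys) = ↭-trans (⊔⊓-↭ x y ys)
    (↭-trans (prep (x ⊔ y) (deposit-raised-↭ (x ⊓ y) ys)) (swap (x ⊔ y) _ ↭-refl))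

  deposit-minimal : ∀ x L {z} → z ∈ x ∷ L → deposit x L Fin.≤ z
  deposit-minimal x [] (here refl) = ℕ.≤-refl
  deposit-minimal x (y ∷ ys) (here refl) =
    ℕ.≤-trans (deposit-minimal (x ⊓ y) ys (here refl)) (⊓-≤ˡ x y)
  deposit-minimal x (y ∷ ys) (there (here refl)) =
    ℕ.≤-trans (deposit-minimal (x ⊓ y) ys (here refl)) (⊓-≤ʳ x y)
  deposit-minimal x (y ∷ ys) (there (there z∈ys)) = deposit-minimal (x ⊓ y) ys (there z∈ys)

-- Slot configurations

Slots : ℕ → Set
Slots N = Fin N → ℕ

Increasing : (Fin N → ℕ) → Set
Increasing f = ∀ a b → a Fin.< b → f a < f b

shift : Slots N → Fin N → Fin N → Slots N
shift σ a b k with k Fin.≟ a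
... | yes _ = pred (σ a)
... | no _ with k Fin.≟ b
...   | yes _ = suc (σ b)
...   | no _  = σ k

module _ (σ : Slots N) (a b : Fin N) where

  shift-lower : shift σ a b a ≡ pred (σ a)
  shift-lower with a Fin.≟ a
  ... | yes _   = refl
  ... | no a≢a = contradiction refl a≢a

  shift-upper : a ≢ b → shift σ a b b ≡ suc (σ b)
  shift-upper a≢b with b Fin.≟ a
  ... | yes b≡a = contradiction (sym b≡a) a≢b
  ... | no _ with b Fin.≟ b
  ...   | yes _   = refl
  ...   | no b≢b = contradiction refl b≢b

  shift-other : ∀ {k} → k ≢ a → k ≢ b → shift σ a b k ≡ σ k
  shift-other {k} k≢a k≢b with k Fin.≟ a
  ... | yes k≡a = contradiction k≡a k≢a
  ... | no _ with k Fin.≟ b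
  ...   | yes k≡b = contradiction k≡b k≢b
  ...   | no _    = refl

-- Slot u is site u − (V + 1), the origin being slot V + 1; the canonical run never goes left of
-- site −(V + 1), so natural-number slots suffice.
module Sites (V : ℕ) where

  site : ℕ → ℤ
  site u = + u ℤ.- + suc V

  ⟦_⟧ : Slots N → Config N
  ⟦ σ ⟧ k = site (σ k)

  private
    cancel : ∀ x w → x ℤ.- w ℤ.+ w ≡ x
    cancel = solve-∀
    suc-comm : ∀ x w → x ℤ.- w ℤ.+ + 1 ≡ + 1 ℤ.+ x ℤ.- w
    suc-comm = solve-∀

  site-injective : ∀ {u v} → site u ≡ site v → u ≡ v
  site-injective {u} {v} eq = ℤ.+-injective (begin
    + u                    ≡⟨ cancel (+ u) (+ suc V) ⟨
    site u ℤ.+ + suc V     ≡⟨ cong (ℤ._+ + suc V) eq ⟩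
    site v ℤ.+ + suc V     ≡⟨ cancel (+ v) (+ suc V) ⟩
    + v                    ∎)
    where open ≡-Reasoning

  site-suc : ∀ u → site u ℤ.+ + 1 ≡ site (suc u)
  site-suc u = suc-comm (+ u) (+ suc V)

  site-pred : ∀ u → site (suc u) ℤ.- + 1 ≡ site u
  site-pred u = begin
    site (suc u) ℤ.- + 1          ≡⟨ cong (ℤ._- + 1) (site-suc u) ⟨
    site u ℤ.+ + 1 ℤ.- + 1        ≡⟨ i+1-1≡i (site u) ⟩
    site u                        ∎
    where open ≡-Reasoning

  site-<-mono : ∀ {u v} → u < v → site u ℤ.< site v
  site-<-mono u<v = ℤ.+-monoˡ-< (ℤ.- + suc V) (ℤ.+<+ u<v)

  site-<-cancel : ∀ {u v} → site u ℤ.< site v → u < v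
  site-<-cancel {u} {v} lt =
    ℤ.drop‿+<+ (subst₂ ℤ._<_ (cancel (+ u) (+ suc V)) (cancel (+ v) (+ suc V))
                            (ℤ.+-monoˡ-< (+ suc V) lt))

  ⟦shift⟧ : ∀ {σ : Slots N} {a b u} → σ a ≡ suc u → ⟦ shift σ a b ⟧ ≗ topple ⟦ σ ⟧ a b
  ⟦shift⟧ {σ = σ} {a} {b} {u} σa k with k Fin.≟ a
  ... | yes _ = begin
    site (pred (σ a))   ≡⟨ cong (site ∘ pred) σa ⟩
    site u                ≡⟨ site-pred u ⟨
    site (suc u) ℤ.- + 1  ≡⟨ cong (λ w → site w ℤ.- + 1) σa ⟨
    site (σ a) ℤ.- + 1    ∎
    where open ≡-Reasoning
  ... | no _ with k Fin.≟ b
  ...   | yes _ = sym (site-suc (σ b))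
  ...   | no _  = refl

  fire : ∀ {σ : Slots N} {a b u} → a Fin.< b → σ a ≡ σ b → σ a ≡ suc u →
         ⟦ σ ⟧ ⟶ ⟦ shift σ a b ⟧
  fire {a = a} {b} a<b σa≡σb σa =
    topples a b a<b (cong site σa≡σb) (≗-sym (⟦shift⟧ {b = b} σa))

  Injective⇒Stable : ∀ {σ : Slots N} → (∀ a b → σ a ≡ σ b → a ≡ b) → Stable ⟦ σ ⟧
  Injective⇒Stable injective a b eq = injective a b (site-injective eq)

  module Firing {σ : Slots N} {x y : Fin N} {t : ℕ}
                (x≢y : x ≢ y) (σx : σ x ≡ suc t) (σy : σ y ≡ suc t) where

    lo hi : Fin N
    lo = x ⊓ y
    hi = x ⊔ y

    at-t : ∀ {z} → z ≡ x ⊎ z ≡ y → σ z ≡ suc t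
    at-t (inj₁ refl) = σx
    at-t (inj₂ refl) = σy

    fired : Slots N
    fired = shift σ lo hi

    step : ⟦ σ ⟧ ⟶ ⟦ fired ⟧
    step = fire (⊓<⊔ x≢y) (trans (at-t (⊓-sel x y)) (sym (at-t (⊔-sel x y)))) (at-t (⊓-sel x y))

    fired-lo : fired lo ≡ t
    fired-lo = trans (shift-lower σ lo hi) (cong pred (at-t (⊓-sel x y)))

    fired-hi : fired hi ≡ suc (suc t)
    fired-hi = trans (shift-upper σ lo hi (Fin.<⇒≢ (⊓<⊔ x≢y))) (cong suc (at-t (⊔-sel x y)))

    fired-other : ∀ {z} → σ z ≢ suc t → fired z ≡ σ z
    fired-other σz≢t = shift-other σ lo hi
      (λ { refl → σz≢t (at-t (⊓-sel x y)) }) (λ { refl → σz≢t (at-t (⊔-sel x y)) })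

    creep-after : (σ′ : Slots N) → σ′ hi ≡ fired hi → (∀ z → σ′ z ≤ suc (fired z)) →
                  ∀ z → σ′ z ≤ suc (σ z)
    creep-after σ′ σ′hi creep z with toSum (z Fin.≟ hi) | toSum (z Fin.≟ lo)
    ... | inj₁ refl | _ =
      ℕ.≤-reflexive (trans σ′hi (trans fired-hi (cong suc (sym (at-t (⊔-sel x y))))))
    ... | inj₂ _ | inj₁ refl = ℕ.≤-trans (creep lo)
      (ℕ.≤-trans (ℕ.≤-reflexive (trans (cong suc fired-lo) (sym (at-t (⊓-sel x y))))) (ℕ.n≤1+n _))
    ... | inj₂ z≢hi | inj₂ z≢lo =
      ℕ.≤-trans (creep z) (ℕ.≤-reflexive (cong suc (shift-other σ lo hi z≢lo z≢hi)))

  ReadsIdentity⇔increasing : ∀ {σ : Slots N} → ReadsIdentity ⟦ σ ⟧ ⇔ Increasing σ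
  ReadsIdentity⇔increasing =
    mk⇔ (λ sorted a b a<b → site-<-cancel (sorted a b a<b))
        (λ increasing a b a<b → site-<-mono (increasing a b a<b))

Laid : Slots N → ℕ → List (Fin N) → Set
Laid σ b []       = ⊤
Laid σ b (z ∷ zs) = σ z ≡ b + length zs × Laid σ b zs

Laid-∈ : ∀ {σ : Slots N} {b L z} → Laid σ b L → z ∈ L → b ≤ σ z × σ z < b + length L
Laid-∈ {b = b} {_ ∷ zs} (σz , _) (here refl) =
  subst (b ≤_) (sym σz) (ℕ.m≤m+n b _) ,
  subst (_< b + suc (length zs)) (sym σz) (ℕ.+-monoʳ-< b (ℕ.n<1+n _))
Laid-∈ {b = b} {_ ∷ zs} (_ , laid) (there z∈zs) with Laid-∈ laid z∈zs
... | b≤σz , σz<b+ℓ = b≤σz , ℕ.<-trans σz<b+ℓ (ℕ.+-monoʳ-< b (ℕ.n<1+n _))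

Laid-cong : ∀ {σ σ′ : Slots N} {b} L → (∀ {z} → z ∈ L → σ z ≡ σ′ z) → Laid σ b L → Laid σ′ b L
Laid-cong []       _  _            = tt
Laid-cong (z ∷ zs) eq (σz , laid) = trans (sym (eq (here refl))) σz , Laid-cong zs (eq ∘ there) laid

Laid-injective : ∀ {σ : Slots N} {b} L {z z′} → Laid σ b L → z ∈ L → z′ ∈ L → σ z ≡ σ z′ → z ≡ z′
Laid-injective (_ ∷ _)  _           (here refl) (here refl) _  = refl
Laid-injective (_ ∷ zs) (σz , laid) (here refl) (there z′∈zs) eq =
  contradiction (trans (sym eq) σz) (ℕ.<⇒≢ (proj₂ (Laid-∈ laid z′∈zs)))
Laid-injective (_ ∷ zs) (σz′ , laid) (there z∈zs) (here refl) eq =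
  contradiction (trans eq σz′) (ℕ.<⇒≢ (proj₂ (Laid-∈ laid z∈zs)))
Laid-injective (_ ∷ zs) (_ , laid) (there z∈zs) (there z′∈zs) eq =
  Laid-injective zs laid z∈zs z′∈zs eq

NotHead : Fin N → List (Fin N) → Set
NotHead x []      = ⊤
NotHead x (y ∷ _) = x ≢ y

not-head : ∀ {σ : Slots N} {b z} L → Laid σ b L → b + length L ≤ σ z → NotHead z L
not-head []       _        _  = tt
not-head {b = b} (y ∷ ys) (σy , _) le refl =
  ℕ.<-irrefl (sym σy) (ℕ.<-≤-trans (ℕ.+-monoʳ-< b (ℕ.n<1+n _)) le)

module Wave (V : ℕ) where
  open Sites V

  record WaveRun (σ : Slots N) (d : ℕ) (x : Fin N) (L : List (Fin N)) : Set where
    field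
      after       : Slots N
      run         : ⟦ σ ⟧ ⟶* ⟦ after ⟧
      raised-laid : Laid after (2 + d) (raised x L)
      deposited   : after (deposit x L) ≡ d
      outside     : ∀ z → σ z ≤ d ⊎ d + length L < σ z → after z ≡ σ z
      creep       : ∀ z → after z ≤ suc (σ z)

  wave-run : ∀ (σ : Slots N) d x L → σ x ≡ d + length L → Laid σ (suc d) L → NotHead x L →
             WaveRun σ d x L
  wave-run σ d x [] σx _ _ = record
    { after       = σ
    ; run         = done (λ _ → refl)
    ; raised-laid = tt
    ; deposited   = trans σx (ℕ.+-identityʳ d)
    ; outside     = λ _ _ → refl
    ; creep       = λ _ → ℕ.n≤1+n _
    }
  wave-run σ d x (y ∷ ys) σx (σy , laid) x≢y = record
    { after       = W.after
    ; run         = step ◅ W.run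
    ; raised-laid = after-hi , W.raised-laid
    ; deposited   = W.deposited
    ; outside     = outside
    ; creep       = creep-after W.after hi-kept W.creep
    }
    where
    ℓ : ℕ
    ℓ = length ys

    open Firing x≢y (trans σx (ℕ.+-suc d ℓ)) σy

    laid₁ : Laid fired (suc d) ys
    laid₁ = Laid-cong ys (λ z∈ys → sym (fired-other (ℕ.<⇒≢ (proj₂ (Laid-∈ laid z∈ys))))) laid

    module W = WaveRun (wave-run fired d lo ys fired-lo laid₁
                                 (not-head ys laid (ℕ.≤-reflexive (sym (at-t (⊓-sel x y))))))

    hi-kept : W.after hi ≡ fired hi
    hi-kept = W.outside hi (inj₂ (subst (d + ℓ <_) (sym fired-hi) (s≤s (ℕ.n≤1+n _))))

    after-hi : W.after hi ≡ 2 + d + length (raised lo ys)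
    after-hi = trans hi-kept
      (trans fired-hi (cong (λ n → suc (suc (d + n))) (sym (length-raised lo ys))))

    outside : ∀ z → σ z ≤ d ⊎ d + suc ℓ < σ z → W.after z ≡ σ z
    outside z (inj₁ σz≤d) = trans (W.outside z (inj₁ (subst (_≤ d) (sym fired-z) σz≤d))) fired-z
      where
      fired-z : fired z ≡ σ z
      fired-z = fired-other (ℕ.<⇒≢ (s≤s (ℕ.≤-trans σz≤d (ℕ.m≤m+n d ℓ))))
    outside z (inj₂ above) = trans (W.outside z (inj₂ (subst (d + ℓ <_) (sym fired-z) below))) fired-z
      where
      fired-z : fired z ≡ σ z
      fired-z = fired-other (λ σz≡top → ℕ.<-irrefl (trans (ℕ.+-suc d ℓ) (sym σz≡top)) above)
      below : d + ℓ < σ z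
      below = ℕ.<-trans (ℕ.+-monoʳ-< d (ℕ.n<1+n ℓ)) above

-- The canonical run

AvoidsGap : ℕ → ℕ → Slots N → Set
AvoidsGap V M σ = ∀ z → σ z ≤ M ⊎ 2 + M ≤ σ z × σ z ≤ 2 + M + V

record Layout (V M : ℕ) (σ₀ : Slots N) : Set where
  field
    extra         : Fin N
    chip          : ℕ → Fin N
    extra-slot    : σ₀ extra ≡ suc V
    chip-slot     : ∀ {i} → i ≤ V + M → σ₀ (chip i) ≡ suc i
    chip≢extra    : ∀ {i} → i ≤ V + M → chip i ≢ extra
    chip-or-extra : ∀ z → z ≡ extra ⊎ ∃[ i ] i ≤ V + M × z ≡ chip i

  slot₀≤ : ∀ z → σ₀ z ≤ suc (V + M)
  slot₀≤ z with chip-or-extra z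
  ... | inj₁ refl = subst (_≤ suc (V + M)) (sym extra-slot) (s≤s (ℕ.m≤m+n V M))
  ... | inj₂ (i , i≤ , refl) = subst (_≤ suc (V + M)) (sym (chip-slot i≤)) (s≤s i≤)

  shared-slot : ∀ {x y} → x ≢ y → σ₀ x ≡ σ₀ y → x ≡ extra ⊎ y ≡ extra
  shared-slot {x} {y} x≢y eq with chip-or-extra x | chip-or-extra y
  ... | inj₁ x≡e | _ = inj₁ x≡e
  ... | inj₂ _ | inj₁ y≡e = inj₂ y≡e
  ... | inj₂ (i , i≤ , refl) | inj₂ (j , j≤ , refl) = contradiction
    (cong chip (ℕ.suc-injective (trans (sym (chip-slot i≤)) (trans eq (chip-slot j≤))))) x≢y

module Canonical {N} (V M : ℕ) (M<N : M < N) (σ₀ : Slots N) (layout : Layout V M σ₀) where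
  open Layout layout
  open Sites V
  open Wave V

  sparse₀ : Sparse ⟦ σ₀ ⟧
  sparse₀ = atMostTwo , separated
    where
    shared : ∀ {x y} → x ≢ y → ⟦ σ₀ ⟧ x ≡ ⟦ σ₀ ⟧ y → x ≡ extra ⊎ y ≡ extra
    shared x≢y eq = shared-slot x≢y (site-injective eq)

    atMostTwo : AtMostTwo ⟦ σ₀ ⟧
    atMostTwo x y z x≢y x≢z y≢z xy xz with shared x≢y xy | shared x≢z xz
    ... | inj₁ x≡e | inj₂ z≡e = x≢z (trans x≡e (sym z≡e))
    ... | inj₂ y≡e | inj₁ x≡e = x≢y (trans x≡e (sym y≡e))
    ... | inj₂ y≡e | inj₂ z≡e = y≢z (trans y≡e (sym z≡e))
    ... | inj₁ x≡e | inj₁ _ with shared y≢z (trans (sym xy) xz)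
    ...   | inj₁ y≡e = x≢y (trans x≡e (sym y≡e))
    ...   | inj₂ z≡e = x≢z (trans x≡e (sym z≡e))

    at-extra : ∀ {q} → Doubled ⟦ σ₀ ⟧ q → q ≡ ⟦ σ₀ ⟧ extra
    at-extra (x , y , x≢y , σx , σy) with shared x≢y (trans σx (sym σy))
    ... | inj₁ refl = sym σx
    ... | inj₂ refl = sym σy

    separated : Separated ⟦ σ₀ ⟧
    separated d₁ d₂ q₁<q₂ = ⊥-elim (ℤ.<-irrefl (trans (at-extra d₁) (sym (at-extra d₂))) q₁<q₂)

  fresh : ℕ → Fin N
  fresh j = chip (j + V)

  fresh-slot₀ : ∀ {j} → j ≤ M → σ₀ (fresh j) ≡ suc (j + V)
  fresh-slot₀ {j} j≤M = chip-slot (subst (j + V ≤_) (ℕ.+-comm M V) (ℕ.+-monoˡ-≤ V j≤M))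

  NearHome : Set
  NearHome = ∀ z → toℕ z ≤ M → σ₀ z ≤ toℕ z + suc V

  record Stage (k : ℕ) : Set where
    field
      σ              : Slots N
      settled        : List (Fin N)
      band           : List (Fin N)
      carrier        : Fin N
      run            : ⟦ σ₀ ⟧ ⟶* ⟦ σ ⟧
      settled-laid   : Laid σ 0 settled
      settled-length : length settled ≡ k
      band-laid      : Laid σ (suc k) band
      band-length    : length band ≡ V
      carrier-slot   : σ carrier ≡ suc (k + V)
      fresh-slot     : ∀ {j} → k ≤ j → j ≤ M → σ (fresh j) ≡ suc (j + V)
      carrier-origin : carrier ≡ extra ⊎ σ₀ carrier < suc (k + V)
      band-origin    : ∀ {z} → z ∈ band → σ₀ z ≤ suc (k + V)
      settled-origin : ∀ {z} → z ∈ settled → σ₀ z ≤ σ z + suc V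
      settled-labels : NearHome → ∀ {z} → z ∈ settled → toℕ z < k
      settled-home   : NearHome → ∀ z → toℕ z < k → σ z ≡ toℕ z
      covers         : ∀ z → z ∈ settled ⊎ z ∈ band ⊎ z ≡ carrier ⊎
                             ∃[ j ] k ≤ j × j ≤ M × z ≡ fresh j
      drift          : ∀ z → σ z ≤ σ₀ z + k

  stage₀ : Stage 0
  stage₀ = record
    { σ              = σ₀
    ; settled        = []
    ; band           = applyDownFrom chip V
    ; carrier        = extra
    ; run            = done (λ _ → refl)
    ; settled-laid   = tt
    ; settled-length = refl
    ; band-laid      = band-laid V ℕ.≤-refl
    ; band-length    = length-applyDownFrom chip V
    ; carrier-slot   = extra-slot
    ; fresh-slot     = λ _ → fresh-slot₀
    ; carrier-origin = inj₁ refl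
    ; band-origin    = band-origin
    ; settled-origin = λ ()
    ; settled-labels = λ _ ()
    ; settled-home   = λ _ _ ()
    ; covers         = covers
    ; drift          = λ z → ℕ.m≤m+n (σ₀ z) 0
    }
    where
    V≤V+M : ∀ {i} → i < V → i ≤ V + M
    V≤V+M i<V = ℕ.≤-trans (ℕ.<⇒≤ i<V) (ℕ.m≤m+n V M)

    band-laid : ∀ i → i ≤ V → Laid σ₀ 1 (applyDownFrom chip i)
    band-laid zero    _   = tt
    band-laid (suc i) i<V =
      trans (chip-slot (V≤V+M i<V)) (cong suc (sym (length-applyDownFrom chip i))) ,
      band-laid i (ℕ.<⇒≤ i<V)

    band-origin : ∀ {z} → z ∈ applyDownFrom chip V → σ₀ z ≤ suc V
    band-origin z∈ with ∈-applyDownFrom⁻ chip z∈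
    ... | i , i<V , refl = ℕ.≤-trans (ℕ.≤-reflexive (chip-slot (V≤V+M i<V))) (ℕ.<⇒≤ (s≤s i<V))

    covers : ∀ z → z ∈ [] ⊎ z ∈ applyDownFrom chip V ⊎ z ≡ extra ⊎
                   ∃[ j ] 0 ≤ j × j ≤ M × z ≡ fresh j
    covers z with chip-or-extra z
    ... | inj₁ z≡extra = inj₂ (inj₂ (inj₁ z≡extra))
    ... | inj₂ (i , i≤ , refl) with i <? V
    ...   | yes i<V = inj₂ (inj₁ (∈-applyDownFrom⁺ chip i<V))
    ...   | no i≮V  = inj₂ (inj₂ (inj₂ (i ∸ V , z≤n ,
      subst (i ∸ V ≤_) (ℕ.m+n∸m≡n V M) (ℕ.∸-monoˡ-≤ V i≤) ,
      cong chip (sym (ℕ.m∸n+n≡m (ℕ.≮⇒≥ i≮V))))))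

  module Next {k : ℕ} (k≤M : k ≤ M) (S : Stage k) where
    open Stage S

    meet : ℕ
    meet = suc (k + V)

    incoming : Fin N
    incoming = fresh k

    σ-incoming : σ incoming ≡ meet
    σ-incoming = fresh-slot ℕ.≤-refl k≤M

    carrier≢incoming : carrier ≢ incoming
    carrier≢incoming carrier≡incoming with carrier-origin
    ... | inj₁ carrier≡extra =
      chip≢extra (ℕ.≤-trans (ℕ.+-monoˡ-≤ V k≤M) (ℕ.≤-reflexive (ℕ.+-comm M V)))
                 (trans (sym carrier≡incoming) carrier≡extra)
    ... | inj₂ σ₀carrier<meet =
      ℕ.<-irrefl (trans (cong σ₀ carrier≡incoming) (fresh-slot₀ k≤M)) σ₀carrier<meet

    open Firing {σ = σ} carrier≢incoming carrier-slot σ-incoming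

    band-below-meet : ∀ {z} → z ∈ band → σ z < meet
    band-below-meet {z} z∈ =
      subst (σ z <_) (cong (_+_ (suc k)) band-length) (proj₂ (Laid-∈ band-laid z∈))

    module W = WaveRun (wave-run fired k lo band (trans fired-lo (cong (_+_ k) (sym band-length)))
      (Laid-cong band (λ z∈ → sym (fired-other (ℕ.<⇒≢ (band-below-meet z∈)))) band-laid)
      (not-head band band-laid (ℕ.≤-reflexive (trans (cong (_+_ (suc k)) band-length)
                                                      (sym (at-t (⊓-sel _ _)))))))

    σ′ : Slots N
    σ′ = W.after

    dep : Fin N
    dep = deposit lo band

    kept : ∀ z → σ z < k ⊎ meet < σ z → σ′ z ≡ σ z
    kept z (inj₁ σz<k) = trans (W.outside z (inj₁ (subst (_≤ k) (sym fired-z) (ℕ.<⇒≤ σz<k)))) fired-z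
      where
      fired-z : fired z ≡ σ z
      fired-z = fired-other (ℕ.<⇒≢ (ℕ.<-trans σz<k (s≤s (ℕ.m≤m+n k V))))
    kept z (inj₂ meet<σz) = trans (W.outside z (inj₂ (subst (_< fired z) (cong (_+_ k) (sym band-length))
        (subst (k + V <_) (sym fired-z) (ℕ.<-trans (ℕ.n<1+n _) meet<σz)))))
      fired-z
      where
      fired-z : fired z ≡ σ z
      fired-z = fired-other (≢-sym (ℕ.<⇒≢ meet<σz))

    hi-kept : σ′ hi ≡ fired hi
    hi-kept = W.outside hi (inj₂ (subst (_< fired hi) (cong (_+_ k) (sym band-length))
      (subst (k + V <_) (sym fired-hi) (ℕ.<-trans (ℕ.n<1+n _) (ℕ.n<1+n _)))))

    wave-members : ∀ {z} → z ∈ dep ∷ raised lo band → z ∈ lo ∷ band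
    wave-members = ∈-resp-↭ (↭-sym (deposit-raised-↭ lo band))

    origin-wave : ∀ {z} → z ∈ lo ∷ band → σ₀ z ≤ meet
    origin-wave (there z∈band) = band-origin z∈band
    origin-wave (here refl) with ⊓-sel carrier incoming
    ... | inj₂ lo≡incoming = ℕ.≤-reflexive (trans (cong σ₀ lo≡incoming) (fresh-slot₀ k≤M))
    ... | inj₁ lo≡carrier with carrier-origin
    ...   | inj₁ carrier≡extra =
      subst (_≤ meet) (sym (trans (cong σ₀ (trans lo≡carrier carrier≡extra)) extra-slot)) (s≤s (ℕ.m≤n+m V k))
    ...   | inj₂ σ₀carrier<meet = ℕ.<⇒≤ (subst (_< meet) (cong σ₀ (sym lo≡carrier)) σ₀carrier<meet)

    -- Under NearHome the chip labelled k is in the wave and has the least label there,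
    -- so it is the one deposited in slot k.
    module Labels (near : NearHome) where

      label≥ : ∀ {z} → k ≤ σ z → k ≤ toℕ z
      label≥ {z} k≤σz =
        ℕ.≮⇒≥ (λ z<k → ℕ.<⇒≱ (subst (_< k) (sym (settled-home near z z<k)) z<k) k≤σz)

      k≤meet : k ≤ meet
      k≤meet = ℕ.≤-trans (ℕ.m≤m+n k V) (ℕ.n≤1+n _)

      wave-label : ∀ {z} → z ∈ lo ∷ band → k ≤ toℕ z
      wave-label (here refl)    = label≥ (subst (k ≤_) (sym (at-t (⊓-sel _ _))) k≤meet)
      wave-label (there z∈band) = label≥ (ℕ.≤-trans (ℕ.n≤1+n k) (proj₁ (Laid-∈ band-laid z∈band)))

      k<N : k < N
      k<N = ℕ.≤-<-trans k≤M M<N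

      κ : Fin N
      κ = Fin.fromℕ< k<N

      κ-label : toℕ κ ≡ k
      κ-label = Fin.toℕ-fromℕ< k<N

      κ∈wave : κ ∈ lo ∷ band
      κ∈wave with covers κ
      ... | inj₁ κ∈settled = contradiction κ-label (ℕ.<⇒≢ (settled-labels near κ∈settled))
      ... | inj₂ (inj₁ κ∈band) = there κ∈band
      ... | inj₂ (inj₂ (inj₁ κ≡carrier)) = here (trans κ≡carrier (sym (x<y⇒x⊓y≡x carrier<incoming)))
        where
        carrier<incoming : carrier Fin.< incoming
        carrier<incoming = Fin.≤∧≢⇒<
          (subst (_≤ toℕ incoming) (trans (sym κ-label) (cong toℕ κ≡carrier))
                 (label≥ (subst (k ≤_) (sym σ-incoming) k≤meet)))
          carrier≢incoming
      ... | inj₂ (inj₂ (inj₂ (j , k≤j , j≤M , κ≡fj))) =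
        here (trans κ≡incoming (sym (y<x⇒x⊓y≡y incoming<carrier)))
        where
        j≤k : j ≤ k
        j≤k = ℕ.+-cancelʳ-≤ V j k (ℕ.≤-pred (begin
          suc (j + V)      ≡⟨ fresh-slot₀ j≤M ⟨
          σ₀ (fresh j)     ≡⟨ cong σ₀ κ≡fj ⟨
          σ₀ κ             ≤⟨ near κ (subst (_≤ M) (sym κ-label) k≤M) ⟩
          toℕ κ + suc V    ≡⟨ cong (_+ suc V) κ-label ⟩
          k + suc V        ≡⟨ ℕ.+-suc k V ⟩
          suc (k + V)      ∎))
          where open ℕ.≤-Reasoning
        κ≡incoming : κ ≡ incoming
        κ≡incoming = trans κ≡fj (cong fresh (ℕ.≤-antisym j≤k k≤j))
        incoming<carrier : incoming Fin.< carrier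
        incoming<carrier = Fin.≤∧≢⇒<
          (subst (_≤ toℕ carrier) (trans (sym κ-label) (cong toℕ κ≡incoming))
                 (label≥ (subst (k ≤_) (sym carrier-slot) k≤meet)))
          (carrier≢incoming ∘ sym)

      dep-label : toℕ dep ≡ k
      dep-label = ℕ.≤-antisym (subst (toℕ dep ≤_) κ-label (deposit-minimal lo band κ∈wave))
                              (wave-label (wave-members (here refl)))

    settled-below : ∀ {z} → z ∈ settled → σ z < k
    settled-below {z} z∈ = subst (σ z <_) settled-length (proj₂ (Laid-∈ settled-laid z∈))

    Covered : Fin N → Set
    Covered z = z ∈ dep ∷ settled ⊎ z ∈ raised lo band ⊎ z ≡ hi ⊎
                ∃[ j ] suc k ≤ j × j ≤ M × z ≡ fresh j

    covered-wave : ∀ {z} → z ∈ lo ∷ band → Covered z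
    covered-wave z∈ with ∈-resp-↭ (deposit-raised-↭ lo band) z∈
    ... | here z≡dep     = inj₁ (here z≡dep)
    ... | there z∈raised = inj₂ (inj₁ z∈raised)

    covered-pair : ∀ {z} → z ≡ carrier ⊎ z ≡ incoming → Covered z
    covered-pair z≡carrier∨incoming with ⊓-⊔-cover z≡carrier∨incoming
    ... | inj₁ z≡lo = covered-wave (here z≡lo)
    ... | inj₂ z≡hi = inj₂ (inj₂ (inj₁ z≡hi))

    covered : ∀ z → Covered z
    covered z with covers z
    ... | inj₁ z∈settled                = inj₁ (there z∈settled)
    ... | inj₂ (inj₁ z∈band)            = covered-wave (there z∈band)
    ... | inj₂ (inj₂ (inj₁ z≡carrier))        = covered-pair (inj₁ z≡carrier)
    ... | inj₂ (inj₂ (inj₂ (j , k≤j , j≤M , z≡fj))) with ℕ.m≤n⇒m<n∨m≡n k≤j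
    ...   | inj₁ k<j  = inj₂ (inj₂ (inj₂ (j , k<j , j≤M , z≡fj)))
    ...   | inj₂ refl = covered-pair (inj₂ z≡fj)

    carrier-origin′ : hi ≡ extra ⊎ σ₀ hi < suc meet
    carrier-origin′ with ⊔-sel carrier incoming
    ... | inj₂ hi≡incoming =
      inj₂ (subst (_< suc meet) (sym (trans (cong σ₀ hi≡incoming) (fresh-slot₀ k≤M))) (ℕ.n<1+n meet))
    ... | inj₁ hi≡carrier with carrier-origin
    ...   | inj₁ carrier≡extra = inj₁ (trans hi≡carrier carrier≡extra)
    ...   | inj₂ σ₀carrier<meet =
      inj₂ (subst (_< suc meet) (cong σ₀ (sym hi≡carrier)) (ℕ.<-trans σ₀carrier<meet (ℕ.n<1+n meet)))

    settled-origin′ : ∀ {z} → z ∈ dep ∷ settled → σ₀ z ≤ σ′ z + suc V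
    settled-origin′ (here refl) =
      subst (σ₀ dep ≤_) (trans (sym (ℕ.+-suc k V)) (cong (_+ suc V) (sym W.deposited)))
            (origin-wave (wave-members (here refl)))
    settled-origin′ {z} (there z∈) =
      subst (λ u → σ₀ z ≤ u + suc V) (sym (kept z (inj₁ (settled-below z∈)))) (settled-origin z∈)

    settled-home′ : NearHome → ∀ z → toℕ z < suc k → σ′ z ≡ toℕ z
    settled-home′ near z z<1+k with ℕ.m≤n⇒m<n∨m≡n (ℕ.≤-pred z<1+k)
    ... | inj₁ z<k = trans (kept z (inj₁ (subst (_< k) (sym home) z<k))) home
      where
      home : σ z ≡ toℕ z
      home = settled-home near z z<k
    ... | inj₂ z≡k = trans (cong σ′ z≡dep) (trans W.deposited (sym z≡k))
      where
      z≡dep : z ≡ dep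
      z≡dep = Fin.toℕ-injective (trans z≡k (sym (Labels.dep-label near)))

    stage′ : Stage (suc k)
    stage′ = record
      { σ              = σ′
      ; settled        = dep ∷ settled
      ; band           = raised lo band
      ; carrier        = hi
      ; run            = run ◅◅ (step ◅ W.run)
      ; settled-laid   = trans W.deposited (sym settled-length) ,
                         Laid-cong settled (λ z∈ → sym (kept _ (inj₁ (settled-below z∈)))) settled-laid
      ; settled-length = cong suc settled-length
      ; band-laid      = W.raised-laid
      ; band-length    = trans (length-raised lo band) band-length
      ; carrier-slot   = trans hi-kept fired-hi
      ; fresh-slot     = λ {j} k<j j≤M → let σj = fresh-slot (ℕ.<⇒≤ k<j) j≤M in
          trans (kept (fresh j) (inj₂ (subst (meet <_) (sym σj) (s≤s (ℕ.+-monoˡ-< V k<j))))) σj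
      ; carrier-origin = carrier-origin′
      ; band-origin    = λ z∈ → ℕ.m≤n⇒m≤1+n (origin-wave (wave-members (there z∈)))
      ; settled-origin = settled-origin′
      ; settled-labels = λ { near (here refl) → s≤s (ℕ.≤-reflexive (Labels.dep-label near))
                           ; near (there z∈) → ℕ.m<n⇒m<1+n (settled-labels near z∈) }
      ; settled-home   = settled-home′
      ; covers         = covered
      ; drift          = λ z → ℕ.≤-trans (creep-after σ′ hi-kept W.creep z)
          (subst (suc (σ z) ≤_) (sym (ℕ.+-suc (σ₀ z) k)) (s≤s (drift z)))
      }

  stage : ∀ k → k ≤ suc M → Stage k
  stage zero    _       = stage₀
  stage (suc k) 1+k≤1+M = Next.stage′ k≤M (stage k (ℕ.m≤n⇒m≤1+n k≤M))
    where
    k≤M : k ≤ M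
    k≤M = ℕ.≤-pred 1+k≤1+M

  record Outcome : Set where
    field
      final        : Slots N
      run          : ⟦ σ₀ ⟧ ⟶* ⟦ final ⟧
      injective    : ∀ a b → final a ≡ final b → a ≡ b
      avoids-gap   : AvoidsGap V M final
      origin-bound : ∀ z → σ₀ z ≤ final z + suc V
      drift        : ∀ z → final z ≤ σ₀ z + suc M
      left-home    : NearHome → ∀ z → toℕ z ≤ M → final z ≡ toℕ z

  outcome : Outcome
  outcome = record
    { final        = σ
    ; run          = run
    ; injective    = injective
    ; avoids-gap   = avoids-gap
    ; origin-bound = origin-bound
    ; drift        = drift
    ; left-home    = λ near z z≤M → settled-home near z (s≤s z≤M)
    }
    where
    open Stage (stage (suc M) ℕ.≤-refl)

    data Region (z : Fin N) : Set where
      left  : z ∈ settled → σ z ≤ M → Region z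
      right : z ∈ band → 2 + M ≤ σ z → σ z ≤ suc M + V → Region z
      top   : z ≡ carrier → Region z

    region : ∀ z → Region z
    region z with covers z
    ... | inj₁ z∈settled = left z∈settled
      (ℕ.≤-pred (subst (σ z <_) settled-length (proj₂ (Laid-∈ settled-laid z∈settled))))
    ... | inj₂ (inj₁ z∈band) = right z∈band (proj₁ (Laid-∈ band-laid z∈band))
      (ℕ.≤-pred (subst (σ z <_) (cong (_+_ (2 + M)) band-length) (proj₂ (Laid-∈ band-laid z∈band))))
    ... | inj₂ (inj₂ (inj₁ z≡carrier)) = top z≡carrier
    ... | inj₂ (inj₂ (inj₂ (j , M<j , j≤M , _))) = contradiction j≤M (ℕ.<⇒≱ M<j)

    M≤1+M+V : M ≤ suc M + V
    M≤1+M+V = ℕ.≤-trans (ℕ.n≤1+n M) (ℕ.m≤m+n (suc M) V)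

    below-band : ∀ {a b} → σ a ≤ M → 2 + M ≤ σ b → σ a < σ b
    below-band a≤M b≥ = ℕ.<-≤-trans (s≤s a≤M) (ℕ.≤-trans (ℕ.n≤1+n _) b≥)

    below-top : ∀ {a} → σ a ≤ suc M + V → σ a < σ carrier
    below-top {a} a≤ = subst (σ a <_) (sym carrier-slot) (s≤s a≤)

    injective : ∀ a b → σ a ≡ σ b → a ≡ b
    injective a b eq with region a | region b
    ... | left a∈ _    | left b∈ _    = Laid-injective settled settled-laid a∈ b∈ eq
    ... | right a∈ _ _ | right b∈ _ _ = Laid-injective band band-laid a∈ b∈ eq
    ... | top refl     | top refl     = refl
    ... | left _ a≤M   | right _ b≥ _ = contradiction eq (ℕ.<⇒≢ (below-band a≤M b≥))
    ... | right _ a≥ _ | left _ b≤M   = contradiction (sym eq) (ℕ.<⇒≢ (below-band b≤M a≥))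
    ... | left _ a≤M   | top refl     = contradiction eq (ℕ.<⇒≢ (below-top (ℕ.≤-trans a≤M M≤1+M+V)))
    ... | top refl     | left _ b≤M   = contradiction (sym eq) (ℕ.<⇒≢ (below-top (ℕ.≤-trans b≤M M≤1+M+V)))
    ... | right _ _ a≤ | top refl     = contradiction eq (ℕ.<⇒≢ (below-top a≤))
    ... | top refl     | right _ _ b≤ = contradiction (sym eq) (ℕ.<⇒≢ (below-top b≤))

    avoids-gap : AvoidsGap V M σ
    avoids-gap z with region z
    ... | left _ z≤M    = inj₁ z≤M
    ... | right _ z≥ z≤ = inj₂ (z≥ , ℕ.m≤n⇒m≤1+n z≤)
    ... | top refl      = inj₂ (subst (2 + M ≤_) (sym carrier-slot) (s≤s (s≤s (ℕ.m≤m+n M V))) ,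
                                ℕ.≤-reflexive carrier-slot)

    origin-bound-right : ∀ {z} → M ≤ σ z → σ₀ z ≤ σ z + suc V
    origin-bound-right {z} M≤σz = ℕ.≤-trans (slot₀≤ z)
      (subst (_≤ σ z + suc V) (trans (ℕ.+-suc M V) (cong suc (ℕ.+-comm M V))) (ℕ.+-monoˡ-≤ (suc V) M≤σz))

    origin-bound : ∀ z → σ₀ z ≤ σ z + suc V
    origin-bound z with region z
    ... | left z∈settled _ = settled-origin z∈settled
    ... | right _ z≥ _     = origin-bound-right (ℕ.≤-trans (ℕ.n≤1+n M) (ℕ.≤-trans (ℕ.n≤1+n _) z≥))
    ... | top refl         = origin-bound-right
                               (subst (M ≤_) (sym carrier-slot) (ℕ.≤-trans M≤1+M+V (ℕ.n≤1+n _)))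

-- Sortability and displacement

toℕ≤increasing : (f : Fin N → ℕ) → Increasing f → ∀ a → toℕ a ≤ f a
toℕ≤increasing {N} f increasing a =
  subst (λ b → toℕ a ≤ f b) (Fin.fromℕ<-toℕ a (Fin.toℕ<n a)) (at (toℕ a) (Fin.toℕ<n a))
  where
  at : ∀ i (i<N : i < N) → i ≤ f (Fin.fromℕ< i<N)
  at zero    _   = z≤n
  at (suc i) i<N = ℕ.≤-<-trans (at i i′<N) (increasing _ _ (subst₂ _<_
    (sym (Fin.toℕ-fromℕ< i′<N)) (sym (Fin.toℕ-fromℕ< i<N)) (ℕ.n<1+n i)))
    where
    i′<N : i < N
    i′<N = ℕ.<-trans (ℕ.n<1+n i) i<N

increasing-bounded⇒toℕ : (f : Fin N → ℕ) → Increasing f → (∀ a → f a < N) → ∀ a → f a ≡ toℕ a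
increasing-bounded⇒toℕ {N} f increasing bounded a = ℕ.≤-antisym f≤ (toℕ≤increasing f increasing a)
  where
  flipped : Fin N → ℕ
  flipped b = N ∸ suc (f (opposite b))

  flipped-increasing : Increasing flipped
  flipped-increasing a b a<b =
    ℕ.∸-monoʳ-< (s≤s (increasing _ _ (opposite-reverses-< a<b))) (bounded (opposite a))

  f≤ : f a ≤ toℕ a
  f≤ = ℕ.≤-pred (ℕ.∸-cancelʳ-≤ (bounded a) (begin
    N ∸ suc (toℕ a)                     ≡⟨ Fin.opposite-prop a ⟨
    toℕ (opposite a)                    ≤⟨ toℕ≤increasing flipped flipped-increasing (opposite a) ⟩
    N ∸ suc (f (opposite (opposite a))) ≡⟨ cong (λ b → N ∸ suc (f b)) (Fin.opposite-involutive a) ⟩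
    N ∸ suc (f a)                       ∎))
    where open ℕ.≤-Reasoning

reflect : Slots N → Slots N
reflect {N} σ z = N ∸ σ (opposite z)

negate-via-sum : ∀ (u w a b : ℤ) → w ℤ.+ u ≡ a ℤ.+ b → ℤ.- (u ℤ.- a) ≡ w ℤ.- b
negate-via-sum u w a b sum = begin
  ℤ.- (u ℤ.- a)             ≡⟨ left u a b ⟩
  a ℤ.+ b ℤ.- u ℤ.- b       ≡⟨ cong (λ x → x ℤ.- u ℤ.- b) sum ⟨
  w ℤ.+ u ℤ.- u ℤ.- b       ≡⟨ right w u b ⟩
  w ℤ.- b                   ∎
  where
  open ≡-Reasoning
  left : ∀ u a b → ℤ.- (u ℤ.- a) ≡ a ℤ.+ b ℤ.- u ℤ.- b
  left = solve-∀
  right : ∀ w u b → w ℤ.+ u ℤ.- u ℤ.- b ≡ w ℤ.- b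
  right = solve-∀

mirror-⟦⟧ : ∀ V M → suc V + suc M ≡ N → (σ : Slots N) → (∀ z → σ z ≤ N) →
            mirror (Sites.⟦_⟧ V σ) ≗ Sites.⟦_⟧ M (reflect σ)
mirror-⟦⟧ {N} V M V+M≡N σ bounded z = negate-via-sum (+ u) (+ (N ∸ u)) (+ suc V) (+ suc M) (begin
  + (N ∸ u) ℤ.+ + u        ≡⟨ ℤ.pos-+ (N ∸ u) u ⟨
  + (N ∸ u + u)            ≡⟨ cong +_ (trans (ℕ.m∸n+n≡m (bounded (opposite z))) (sym V+M≡N)) ⟩
  + (suc V + suc M)        ≡⟨ ℤ.pos-+ (suc V) (suc M) ⟩
  + suc V ℤ.+ + suc M      ∎)
  where
  open ≡-Reasoning
  u : ℕ
  u = σ (opposite z)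

reflect-layout : ∀ {V M} {σ₀ : Slots N} → suc V + suc M ≡ N → Layout V M σ₀ → Layout M V (reflect σ₀)
reflect-layout {N} {V} {M} {σ₀} V+M≡N layout = record
  { extra         = opposite extra
  ; chip          = λ i → opposite (chip (V + M ∸ i))
  ; extra-slot    = begin
      N ∸ σ₀ (opposite (opposite extra))  ≡⟨ cong (λ b → N ∸ σ₀ b) (Fin.opposite-involutive extra) ⟩
      N ∸ σ₀ extra                        ≡⟨ cong₂ _∸_ (sym V+M≡N) extra-slot ⟩
      suc V + suc M ∸ suc V               ≡⟨ ℕ.m+n∸m≡n (suc V) (suc M) ⟩
      suc M                               ∎
  ; chip-slot     = chip-slot′
  ; chip≢extra    = λ {i} _ eq → chip≢extra (ℕ.m∸n≤m (V + M) i) (opposite-injective eq)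
  ; chip-or-extra = chip-or-extra′
  }
  where
  open Layout layout
  open ≡-Reasoning

  chip-slot′ : ∀ {i} → i ≤ M + V → N ∸ σ₀ (opposite (opposite (chip (V + M ∸ i)))) ≡ suc i
  chip-slot′ {i} i≤M+V = begin
    N ∸ σ₀ (opposite (opposite (chip j)))  ≡⟨ cong (λ b → N ∸ σ₀ b) (Fin.opposite-involutive (chip j)) ⟩
    N ∸ σ₀ (chip j)                        ≡⟨ cong₂ _∸_ (sym V+M≡N) (chip-slot (ℕ.m∸n≤m (V + M) i)) ⟩
    suc V + suc M ∸ suc j                  ≡⟨ cong (_∸ suc j) sum ⟩
    suc i + suc j ∸ suc j                  ≡⟨ ℕ.m+n∸n≡m (suc i) (suc j) ⟩
    suc i                                  ∎
    where
    j : ℕ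
    j = V + M ∸ i
    sum : suc V + suc M ≡ suc i + suc j
    sum = trans (cong suc (ℕ.+-suc V M))
          (trans (cong (suc ∘ suc) (sym (ℕ.m+[n∸m]≡n (subst (i ≤_) (ℕ.+-comm M V) i≤M+V))))
                 (cong suc (sym (ℕ.+-suc i j))))

  chip-or-extra′ : ∀ z → z ≡ opposite extra ⊎ ∃[ i ] i ≤ M + V × z ≡ opposite (chip (V + M ∸ i))
  chip-or-extra′ z with chip-or-extra (opposite z)
  ... | inj₁ z̄≡extra = inj₁ (trans (sym (Fin.opposite-involutive z)) (cong opposite z̄≡extra))
  ... | inj₂ (j , j≤ , z̄≡chip) =
    inj₂ (V + M ∸ j , subst (V + M ∸ j ≤_) (ℕ.+-comm V M) (ℕ.m∸n≤m (V + M) j) ,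
      trans (sym (Fin.opposite-involutive z))
            (cong opposite (trans z̄≡chip (cong chip (sym (ℕ.m∸[m∸n]≡n j≤))))))

Sortable : Config N → Set
Sortable c = ∃[ t ] c ⟶* t × Stable t × ReadsIdentity t

Sortable-resp : ∀ {c d : Config N} → c ≗ d → Sortable c → Sortable d
Sortable-resp c≗d (t , run , stable , sorted) = t , ⟶*-respˡ c≗d run , stable , sorted

opposite-+ : (z : Fin N) → toℕ (opposite z) + suc (toℕ z) ≡ N
opposite-+ z = trans (cong (_+ suc (toℕ z)) (Fin.opposite-prop z)) (ℕ.m∸n+n≡m (Fin.toℕ<n z))

-- The slot of chip z in the sorted stable configuration, whose only hole is slot M + 1.
gapped : ℕ → Fin N → ℕ
gapped M z with toℕ z ≤? M
... | yes _ = toℕ z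
... | no _  = suc (toℕ z)

module _ {M : ℕ} where

  gapped-left : ∀ {z : Fin N} → toℕ z ≤ M → gapped M z ≡ toℕ z
  gapped-left {z = z} z≤M with toℕ z ≤? M
  ... | yes _   = refl
  ... | no z≰M = contradiction z≤M z≰M

  gapped-right : ∀ {z : Fin N} → M < toℕ z → gapped M z ≡ suc (toℕ z)
  gapped-right {z = z} M<z with toℕ z ≤? M
  ... | yes z≤M = contradiction z≤M (ℕ.<⇒≱ M<z)
  ... | no _    = refl

  gapped-increasing : Increasing {N} (gapped M)
  gapped-increasing a b a<b with toℕ a ≤? M | toℕ b ≤? M
  ... | yes _   | yes _   = a<b
  ... | yes _   | no _    = ℕ.m<n⇒m<1+n a<b
  ... | no a≰M  | yes b≤M = contradiction (ℕ.≤-trans (ℕ.<⇒≤ a<b) b≤M) a≰M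
  ... | no _    | no _    = s≤s a<b

AvoidsGap⇒≤ : ∀ {V M} {σ : Slots N} → AvoidsGap V M σ → ∀ z → σ z ≤ 2 + M + V
AvoidsGap⇒≤ {V = V} {M} avoids z =
  [ (λ z≤M → ℕ.≤-trans z≤M (ℕ.≤-trans (ℕ.m≤m+n M V) (ℕ.≤-trans (ℕ.n≤1+n _) (ℕ.n≤1+n _)))) , proj₂ ]
  (avoids z)

increasing⇒gapped : ∀ {V M} (σ : Slots (2 + V + M)) → AvoidsGap V M σ → Increasing σ →
                    ∀ z → σ z ≡ gapped M z
increasing⇒gapped {V} {M} σ avoids increasing z =
  uncollapse z (increasing-bounded⇒toℕ (collapse ∘ σ) collapse-increasing bounded z)
  where
  collapse : ℕ → ℕ
  collapse u with u ≤? M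
  ... | yes _ = u
  ... | no _  = pred u

  collapse-increasing : Increasing (collapse ∘ σ)
  collapse-increasing a b a<b with σ a ≤? M | σ b ≤? M | avoids b
  ... | yes _    | yes _    | _ = increasing a b a<b
  ... | yes a≤M  | no _     | inj₂ (b≥ , _) = ℕ.≤-<-trans a≤M (ℕ.pred-mono-≤ b≥)
  ... | yes _    | no b≰M   | inj₁ b≤M = contradiction b≤M b≰M
  ... | no a≰M   | yes b≤M  | _ = contradiction (ℕ.≤-trans (ℕ.<⇒≤ (increasing a b a<b)) b≤M) a≰M
  ... | no a≰M   | no _     | _ = pred-< (ℕ.≰⇒> a≰M) (increasing a b a<b)
    where
    pred-< : ∀ {u v} → M < u → u < v → pred u < pred v
    pred-< {suc u} {suc v} _ (s≤s u<v) = u<v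

  bounded : ∀ z → collapse (σ z) < 2 + V + M
  bounded z with σ z ≤? M | avoids z
  ... | yes z≤M | _ = s≤s (ℕ.≤-trans z≤M (ℕ.≤-trans (ℕ.m≤n+m M V) (ℕ.n≤1+n _)))
  ... | no z≰M | inj₁ z≤M = contradiction z≤M z≰M
  ... | no _ | inj₂ (_ , z≤) = s≤s (subst (pred (σ z) ≤_) (cong suc (ℕ.+-comm M V)) (ℕ.pred-mono-≤ z≤))

  uncollapse : ∀ z → collapse (σ z) ≡ toℕ z → σ z ≡ gapped M z
  uncollapse z eq with σ z ≤? M | avoids z
  ... | yes z≤M | _ = trans eq (sym (gapped-left (subst (_≤ M) eq z≤M)))
  ... | no z≰M | inj₁ z≤M = contradiction z≤M z≰M
  ... | no _ | inj₂ (z≥ , _) = begin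
    σ z               ≡⟨ ℕ.suc-pred (σ z) {{>-nonZero (ℕ.<-≤-trans (s≤s z≤n) z≥)}} ⟨
    suc (pred (σ z))  ≡⟨ cong suc eq ⟩
    suc (toℕ z)       ≡⟨ gapped-right (subst (M <_) eq (ℕ.pred-mono-≤ z≥)) ⟨
    gapped M z        ∎
    where open ≡-Reasoning

split-sum : ∀ {V M a b} → a + b ≡ suc (V + M) → a ≤ V ⇔ M < b
split-sum {V} {M} {a} {b} sum = mk⇔
  (λ a≤V → ℕ.+-cancelˡ-≤ V (suc M) b (begin
    V + suc M   ≡⟨ ℕ.+-suc V M ⟩
    suc (V + M) ≡⟨ sum ⟨
    a + b       ≤⟨ ℕ.+-monoˡ-≤ b a≤V ⟩
    V + b       ∎))
  (λ M<b → ℕ.+-cancelʳ-≤ (suc M) a V (begin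
    a + suc M   ≤⟨ ℕ.+-monoʳ-≤ a M<b ⟩
    a + b       ≡⟨ sum ⟩
    suc (V + M) ≡⟨ ℕ.+-suc V M ⟨
    V + suc M   ∎))
  where open ℕ.≤-Reasoning

opposite-split : ∀ {V M} (z : Fin (2 + V + M)) → toℕ (opposite z) ≤ V ⇔ M < toℕ z
opposite-split z = split-sum (ℕ.suc-injective (trans (sym (ℕ.+-suc _ _)) (opposite-+ z)))

module Sorting {V M : ℕ} {σ₀ : Slots (2 + V + M)} (layout : Layout V M σ₀) where
  open Sites V

  private
    V+M≡N : suc V + suc M ≡ 2 + V + M
    V+M≡N = cong suc (ℕ.+-suc V M)

    M+V≡N : suc M + suc V ≡ 2 + V + M
    M+V≡N = trans (ℕ.+-comm (suc M) (suc V)) V+M≡N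

  module Left  = Canonical V M (s≤s (ℕ.≤-trans (ℕ.m≤n+m M V) (ℕ.n≤1+n _))) σ₀ layout
  module Right = Canonical M V (s≤s (ℕ.≤-trans (ℕ.m≤m+n V M) (ℕ.n≤1+n _))) (reflect σ₀)
                           (reflect-layout V+M≡N layout)
  open Left.Outcome Left.outcome
  module R = Right.Outcome Right.outcome

  Reachable : Fin (2 + V + M) → Set
  Reachable z = σ₀ z ≤ gapped M z + suc V × gapped M z ≤ σ₀ z + suc M

  final-stable : Stable ⟦ final ⟧
  final-stable = Injective⇒Stable injective

  sortable⇒reachable : Sortable ⟦ σ₀ ⟧ → ∀ z → Reachable z
  sortable⇒reachable (t , run-t , stable-t , sorted-t) z =
    subst (λ u → σ₀ z ≤ u + suc V) (final≡gapped z) (origin-bound z) ,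
    subst (_≤ σ₀ z + suc M) (final≡gapped z) (drift z)
    where
    final≗t : ⟦ final ⟧ ≗ t
    final≗t = stable-unique Left.sparse₀ run final-stable run-t stable-t

    final≡gapped : ∀ z → final z ≡ gapped M z
    final≡gapped = increasing⇒gapped final avoids-gap
      (Equivalence.to ReadsIdentity⇔increasing (ReadsIdentity-resp (≗-sym final≗t) sorted-t))

  reachable⇒sortable : (∀ z → Reachable z) → Sortable ⟦ σ₀ ⟧
  reachable⇒sortable reach = ⟦ final ⟧ , run , final-stable ,
    Equivalence.from ReadsIdentity⇔increasing (λ a b a<b →
      subst₂ _<_ (sym (final≡gapped a)) (sym (final≡gapped b)) (gapped-increasing a b a<b))
    where
    near-left : Left.NearHome
    near-left z z≤M = subst (λ u → σ₀ z ≤ u + suc V) (gapped-left z≤M) (proj₁ (reach z))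

    near-right : Right.NearHome
    near-right z̄ z̄≤V = ℕ.m≤n+o⇒m∸n≤o _ (σ₀ z) (begin
      2 + V + M                       ≡⟨ opposite-+ z̄ ⟨
      toℕ z + suc (toℕ z̄)             ≡⟨ ℕ.+-suc (toℕ z) (toℕ z̄) ⟩
      suc (toℕ z) + toℕ z̄             ≡⟨ cong (_+ toℕ z̄) (gapped-right M<z) ⟨
      gapped M z + toℕ z̄              ≤⟨ ℕ.+-monoˡ-≤ (toℕ z̄) (proj₂ (reach z)) ⟩
      σ₀ z + suc M + toℕ z̄            ≡⟨ ℕ.+-assoc (σ₀ z) (suc M) (toℕ z̄) ⟩
      σ₀ z + (suc M + toℕ z̄)          ≡⟨ cong (_+_ (σ₀ z)) (ℕ.+-comm (suc M) (toℕ z̄)) ⟩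
      σ₀ z + (toℕ z̄ + suc M)          ∎)
      where
      open ℕ.≤-Reasoning
      z : Fin (2 + V + M)
      z = opposite z̄
      M<z : M < toℕ z
      M<z = Equivalence.to (opposite-split {V} {M} z)
              (subst (λ w → toℕ w ≤ V) (sym (Fin.opposite-involutive z̄)) z̄≤V)

    bounded₀ : ∀ z → σ₀ z ≤ 2 + V + M
    bounded₀ z = ℕ.m≤n⇒m≤1+n (Layout.slot₀≤ layout z)

    reflected : Slots (2 + V + M)
    reflected = reflect R.final

    mirror-final≗ : mirror (Sites.⟦_⟧ M R.final) ≗ ⟦ reflected ⟧
    mirror-final≗ = mirror-⟦⟧ M V M+V≡N R.final (AvoidsGap⇒≤ R.avoids-gap)

    reflected-run : ⟦ σ₀ ⟧ ⟶* ⟦ reflected ⟧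
    reflected-run = ⟶*-respˡ (≗-trans (mirror-cong (≗-sym (mirror-⟦⟧ V M V+M≡N σ₀ bounded₀)))
                                      (mirror-involutive ⟦ σ₀ ⟧))
                              (⟶*-respʳ (mirror-⟶* R.run) mirror-final≗)

    reflected-stable : Stable ⟦ reflected ⟧
    reflected-stable = Stable-resp mirror-final≗ (Stable-mirror (Sites.Injective⇒Stable M R.injective))

    final≡gapped : ∀ z → final z ≡ gapped M z
    final≡gapped z with toSum (toℕ z ≤? M)
    ... | inj₁ z≤M = trans (left-home near-left z z≤M) (sym (gapped-left z≤M))
    ... | inj₂ z≰M = begin
      final z                              ≡⟨ site-injective (stable-unique Left.sparse₀ run final-stable
                                                                reflected-run reflected-stable z) ⟩
      2 + V + M ∸ R.final (opposite z)     ≡⟨ cong (2 + V + M ∸_) (R.left-home near-right (opposite z)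
                                                (Equivalence.from (opposite-split z) M<z)) ⟩
      2 + V + M ∸ toℕ (opposite z)         ≡⟨ cong (2 + V + M ∸_) (Fin.opposite-prop z) ⟩
      2 + V + M ∸ (2 + V + M ∸ suc (toℕ z)) ≡⟨ ℕ.m∸[m∸n]≡n (Fin.toℕ<n z) ⟩
      suc (toℕ z)                          ≡⟨ gapped-right M<z ⟨
      gapped M z                           ∎
      where
      open ≡-Reasoning
      M<z : M < toℕ z
      M<z = ℕ.≰⇒> z≰M

-- The initial configuration π^(r)

toℕ-punchIn-< : ∀ (i : Fin (suc n)) j → toℕ j < toℕ i → toℕ (punchIn i j) ≡ toℕ j
toℕ-punchIn-< (Fin.suc i) Fin.zero    _         = refl
toℕ-punchIn-< (Fin.suc i) (Fin.suc j) (s≤s j<i) = cong suc (toℕ-punchIn-< i j j<i)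

toℕ-punchIn-≥ : ∀ (i : Fin (suc n)) j → toℕ i ≤ toℕ j → toℕ (punchIn i j) ≡ suc (toℕ j)
toℕ-punchIn-≥ Fin.zero    j           _         = refl
toℕ-punchIn-≥ (Fin.suc i) (Fin.suc j) (s≤s i≤j) = cong suc (toℕ-punchIn-≥ i j i≤j)

Toppleable⇔Sortable : ∀ {π : Permutation′ n} {r} → Toppleable π r ⇔ Sortable (initial π r)
Toppleable⇔Sortable = mk⇔
  (λ (t , run , stable , sorted) → t , Star⇒⟶* run , stable , sorted)
  (λ (t , run , stable , sorted) → let (t′ , run′ , t′≗t) = ⟶*⇒Star (λ _ → refl) run in
    t′ , run′ , Stable-resp (≗-sym t′≗t) stable , ReadsIdentity-resp (≗-sym t′≗t) sorted)

Within : ℕ → ℕ → ℕ → ℕ → Set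
Within V M q v = q ≤ v + V × v ≤ q + M

Displacement : ∀ V M → Permutation′ n → Set
Displacement V M π = ∀ q → Within V M (toℕ q) (toℕ (π ⟨$⟩ʳ q))

within-below : ∀ {V M q v} → v < M → (suc q ≤ v + suc V × v ≤ suc q + suc M) ⇔ Within V M q v
within-below {V} {M} {q} {v} v<M = mk⇔
  (λ (q<v+1+V , _) → ℕ.≤-pred (subst (suc q ≤_) (ℕ.+-suc v V) q<v+1+V) , v≤q+M)
  (λ (q≤v+V , _) → subst (suc q ≤_) (sym (ℕ.+-suc v V)) (s≤s q≤v+V) ,
                   ℕ.≤-trans v≤q+M (ℕ.+-mono-≤ (ℕ.n≤1+n q) (ℕ.n≤1+n M)))
  where
  v≤q+M : v ≤ q + M
  v≤q+M = ℕ.≤-trans (ℕ.<⇒≤ v<M) (ℕ.m≤n+m M q)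

within-above : ∀ {V M q v} → q ≤ V + M → M ≤ v →
               (suc q ≤ suc (suc v) + suc V × suc (suc v) ≤ suc q + suc M) ⇔ Within V M q v
within-above {V} {M} {q} {v} q≤V+M M≤v = mk⇔
  (λ (_ , 2+v≤q+1+M) → q≤v+V ,
     ℕ.≤-pred (ℕ.≤-pred (subst (suc (suc v) ≤_) (cong suc (ℕ.+-suc q M)) 2+v≤q+1+M)))
  (λ (_ , v≤q+M) → s≤s (ℕ.≤-trans q≤v+V (ℕ.+-mono-≤ (ℕ.n≤1+n v) (ℕ.n≤1+n V))) ,
                   subst (suc (suc v) ≤_) (sym (cong suc (ℕ.+-suc q M))) (s≤s (s≤s v≤q+M)))
  where
  q≤v+V : q ≤ v + V
  q≤v+V = ℕ.≤-trans q≤V+M (subst (V + M ≤_) (ℕ.+-comm V v) (ℕ.+-monoʳ-≤ V M≤v))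

module Initial {V M : ℕ} (π : Permutation′ (suc (V + M))) (r : Fin (2 + V + M)) (r≡M : toℕ r ≡ M)
  where

  slot₀ : Slots (2 + V + M)
  slot₀ k with r Fin.≟ k
  ... | yes _  = suc V
  ... | no r≢k = suc (toℕ (π ⟨$⟩ˡ punchOut r≢k))

  initial≗ : (V + M) / 2 ≡ V → initial π r ≗ Sites.⟦_⟧ V slot₀
  initial≗ half k with r Fin.≟ k
  ... | yes _  = sym (ℤ.+-inverseʳ (+ suc V))
  ... | no r≢k = trans (cong (λ h → + i ℤ.- + h) half)
                       (trans (shift₁ (+ i) (+ V)) (cong (ℤ._- + suc V) (sym (ℤ.pos-+ 1 i))))
    where
    i : ℕ
    i = toℕ (π ⟨$⟩ˡ punchOut r≢k)
    shift₁ : ∀ a b → a ℤ.- b ≡ + 1 ℤ.+ a ℤ.- (+ 1 ℤ.+ b)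
    shift₁ = solve-∀

  -- Indices beyond V + M are never used; they are sent to r.
  chip : ℕ → Fin (2 + V + M)
  chip i with i <? suc (V + M)
  ... | yes i<n = punchIn r (π ⟨$⟩ʳ Fin.fromℕ< i<n)
  ... | no _    = r

  chip-toℕ : ∀ q → chip (toℕ q) ≡ punchIn r (π ⟨$⟩ʳ q)
  chip-toℕ q with toℕ q <? suc (V + M)
  ... | yes q<n = cong (punchIn r ∘ (π ⟨$⟩ʳ_)) (Fin.fromℕ<-toℕ q q<n)
  ... | no q≮n  = contradiction (Fin.toℕ<n q) q≮n

  slot₀-chip : ∀ q → slot₀ (punchIn r (π ⟨$⟩ʳ q)) ≡ suc (toℕ q)
  slot₀-chip q with r Fin.≟ punchIn r (π ⟨$⟩ʳ q)
  ... | yes r≡ = contradiction (sym r≡) (Fin.punchInᵢ≢i r _)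
  ... | no _   = cong (suc ∘ toℕ) (trans
      (cong (π ⟨$⟩ˡ_) (trans (Fin.punchOut-cong r refl) (Fin.punchOut-punchIn r)))
      (inverseˡ π))

  chip-index : ∀ {i} (i≤ : i ≤ V + M) → chip i ≡ punchIn r (π ⟨$⟩ʳ Fin.fromℕ< (s≤s i≤))
  chip-index i≤ = trans (cong chip (sym (Fin.toℕ-fromℕ< (s≤s i≤)))) (chip-toℕ _)

  layout : Layout V M slot₀
  layout = record
    { extra         = r
    ; chip          = chip
    ; extra-slot    = extra-slot
    ; chip-slot     = λ i≤ → trans (cong slot₀ (chip-index i≤))
                                    (trans (slot₀-chip _) (cong suc (Fin.toℕ-fromℕ< (s≤s i≤))))
    ; chip≢extra    = λ i≤ eq → Fin.punchInᵢ≢i r _ (trans (sym (chip-index i≤)) eq)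
    ; chip-or-extra = chip-or-extra
    }
    where
    extra-slot : slot₀ r ≡ suc V
    extra-slot with r Fin.≟ r
    ... | yes _  = refl
    ... | no r≢r = contradiction refl r≢r

    chip-or-extra : ∀ z → z ≡ r ⊎ ∃[ i ] i ≤ V + M × z ≡ chip i
    chip-or-extra z with r Fin.≟ z
    ... | yes r≡z  = inj₁ (sym r≡z)
    ... | no r≢z = inj₂ (toℕ q , ℕ.≤-pred (Fin.toℕ<n q) , (begin
      z                            ≡⟨ Fin.punchIn-punchOut r≢z ⟨
      punchIn r (punchOut r≢z)     ≡⟨ cong (punchIn r) (inverseʳ π) ⟨
      punchIn r (π ⟨$⟩ʳ q)         ≡⟨ chip-toℕ q ⟨
      chip (toℕ q)                 ∎))
      where
      open ≡-Reasoning
      q : Fin (suc (V + M))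
      q = π ⟨$⟩ˡ punchOut r≢z

  open Sorting layout using (Reachable; sortable⇒reachable; reachable⇒sortable)

  reachable-at : ∀ {z s g} → slot₀ z ≡ s → gapped M z ≡ g →
                 Reachable z ⇔ (s ≤ g + suc V × g ≤ s + suc M)
  reachable-at refl refl = ⇔-refl

  reachable-extra : Reachable r
  reachable-extra =
    Equivalence.from
      (reachable-at (Layout.extra-slot layout) (trans (gapped-left (ℕ.≤-reflexive r≡M)) r≡M))
      (ℕ.m≤n+m (suc V) M , ℕ.≤-trans (ℕ.n≤1+n M) (ℕ.m≤n+m (suc M) (suc V)))

  gapped-punchIn-< : ∀ w → toℕ w < M → gapped M (punchIn r w) ≡ toℕ w
  gapped-punchIn-< w w<M = trans (gapped-left (ℕ.≤-trans (ℕ.≤-reflexive z≡w) (ℕ.<⇒≤ w<M))) z≡w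
    where
    z≡w : toℕ (punchIn r w) ≡ toℕ w
    z≡w = toℕ-punchIn-< r w (subst (toℕ w <_) (sym r≡M) w<M)

  gapped-punchIn-≥ : ∀ w → M ≤ toℕ w → gapped M (punchIn r w) ≡ suc (suc (toℕ w))
  gapped-punchIn-≥ w M≤w = trans (gapped-right (subst (M <_) (sym z≡1+w) (s≤s M≤w))) (cong suc z≡1+w)
    where
    z≡1+w : toℕ (punchIn r w) ≡ suc (toℕ w)
    z≡1+w = toℕ-punchIn-≥ r w (subst (_≤ toℕ w) (sym r≡M) M≤w)

  reachable-chip : ∀ q → Reachable (punchIn r (π ⟨$⟩ʳ q)) ⇔ Within V M (toℕ q) (toℕ (π ⟨$⟩ʳ q))
  reachable-chip q with toSum (toℕ (π ⟨$⟩ʳ q) <? M)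
  ... | inj₁ v<M = ⇔-trans (reachable-at (slot₀-chip q) (gapped-punchIn-< _ v<M)) (within-below v<M)
  ... | inj₂ v≮M = ⇔-trans (reachable-at (slot₀-chip q) (gapped-punchIn-≥ _ (ℕ.≮⇒≥ v≮M)))
                           (within-above (Fin.toℕ≤pred[n] q) (ℕ.≮⇒≥ v≮M))

  reachable⇔displacement : (∀ z → Reachable z) ⇔ Displacement V M π
  reachable⇔displacement = mk⇔
    (λ reach q → Equivalence.to (reachable-chip q) (reach _))
    (λ within z → reachable within z)
    where
    reachable : Displacement V M π → ∀ z → Reachable z
    reachable within z with Layout.chip-or-extra layout z
    ... | inj₁ refl            = reachable-extra
    ... | inj₂ (i , i≤ , refl) =
      subst Reachable (sym (chip-index i≤)) (Equivalence.from (reachable-chip _) (within _))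

  toppleable⇔displacement : (V + M) / 2 ≡ V → Toppleable π r ⇔ Displacement V M π
  toppleable⇔displacement half = begin
    Toppleable π r                   ≈⟨ Toppleable⇔Sortable {π = π} {r} ⟩
    Sortable (initial π r)           ≈⟨ mk⇔ (Sortable-resp (initial≗ half))
                                                (Sortable-resp (≗-sym (initial≗ half))) ⟩
    Sortable (Sites.⟦_⟧ V slot₀)     ≈⟨ mk⇔ sortable⇒reachable reachable⇒sortable ⟩
    (∀ z → Reachable z)              ≈⟨ reachable⇔displacement ⟩
    Displacement V M π               ∎
    where open ⇔-Reasoning

-- The four stated forms

∸≤⇒≤+ : ∀ a b c → a ∸ b ≤ c → a ≤ c + b
∸≤⇒≤+ a b c le =
  ℕ.≤-trans (ℕ.m≤n+m∸n a b) (subst (b + (a ∸ b) ≤_) (ℕ.+-comm b c) (ℕ.+-monoʳ-≤ b le))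

≤+⇒∸≤ : ∀ a b c → a ≤ c + b → a ∸ b ≤ c
≤+⇒∸≤ a b c le = ℕ.m≤n+o⇒m∸n≤o a b (subst (a ≤_) (ℕ.+-comm c b) le)

+-suc-comm : ∀ a b → a + suc b ≡ suc (b + a)
+-suc-comm a b = trans (ℕ.+-suc a b) (cong suc (ℕ.+-comm a b))

module _ {m q v : ℕ} (q≤ : q ≤ m + m) (v≤ : v ≤ m + m) where

  within-odd-val : Within m m q v ⇔
    ((suc q ≤ m → suc v ≤ m + suc q) × (suc m ≤ suc q → suc q ∸ m ≤ suc v))
  within-odd-val = mk⇔
    (λ (q≤v+m , v≤q+m) → (λ _ → subst (suc v ≤_) (sym (+-suc-comm m q)) (s≤s v≤q+m)) ,
                         (λ _ → ≤+⇒∸≤ (suc q) m (suc v) (s≤s q≤v+m)))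
    (λ (left , right) → q≤v+m right , v≤q+m left)
    where
    q≤v+m : (suc m ≤ suc q → suc q ∸ m ≤ suc v) → q ≤ v + m
    q≤v+m right with q <? m
    ... | yes q<m = ℕ.≤-trans (ℕ.<⇒≤ q<m) (ℕ.m≤n+m m v)
    ... | no q≮m  = ℕ.≤-pred (∸≤⇒≤+ (suc q) m (suc v) (right (s≤s (ℕ.≮⇒≥ q≮m))))
    v≤q+m : (suc q ≤ m → suc v ≤ m + suc q) → v ≤ q + m
    v≤q+m left with q <? m
    ... | yes q<m = ℕ.≤-pred (subst (suc v ≤_) (+-suc-comm m q) (left q<m))
    ... | no q≮m  = ℕ.≤-trans v≤ (ℕ.+-monoˡ-≤ m (ℕ.≮⇒≥ q≮m))

  within-odd-pos : Within m m q v ⇔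
    ((suc v ≤ suc m → suc q ≤ m + suc v) × (suc (suc m) ≤ suc v → suc v ∸ m ≤ suc q))
  within-odd-pos = mk⇔
    (λ (q≤v+m , v≤q+m) → (λ _ → subst (suc q ≤_) (sym (+-suc-comm m v)) (s≤s q≤v+m)) ,
                         (λ _ → ≤+⇒∸≤ (suc v) m (suc q) (s≤s v≤q+m)))
    (λ (left , right) → q≤v+m left , v≤q+m right)
    where
    q≤v+m : (suc v ≤ suc m → suc q ≤ m + suc v) → q ≤ v + m
    q≤v+m left with v ℕ.≤? m
    ... | yes v≤m = ℕ.≤-pred (subst (suc q ≤_) (+-suc-comm m v) (left (s≤s v≤m)))
    ... | no v≰m  = ℕ.≤-trans q≤ (ℕ.+-monoˡ-≤ m (ℕ.<⇒≤ (ℕ.≰⇒> v≰m)))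
    v≤q+m : (suc (suc m) ≤ suc v → suc v ∸ m ≤ suc q) → v ≤ q + m
    v≤q+m right with v ℕ.≤? m
    ... | yes v≤m = ℕ.≤-trans v≤m (ℕ.m≤n+m m q)
    ... | no v≰m  = ℕ.≤-pred (∸≤⇒≤+ (suc v) m (suc q) (right (s≤s (ℕ.≰⇒> v≰m))))

module _ {k q v : ℕ} (q≤ : q ≤ k + suc k) (v≤ : v ≤ k + suc k) where

  within-even-val : Within k (suc k) q v ⇔
    ((suc q ≤ suc k → suc v ≤ suc k + suc q) × (suc (suc k) ≤ suc q → suc (suc q ∸ suc k) ≤ suc v))
  within-even-val = mk⇔
    (λ (q≤v+k , v≤q+m) → (λ _ → subst (suc v ≤_) (sym (+-suc-comm (suc k) q)) (s≤s v≤q+m)) ,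
                         (λ _ → s≤s (≤+⇒∸≤ (suc q) (suc k) v (subst (suc q ≤_) (sym (ℕ.+-suc v k)) (s≤s q≤v+k)))))
    (λ (left , right) → q≤v+k right , v≤q+m left)
    where
    q≤v+k : (suc (suc k) ≤ suc q → suc (suc q ∸ suc k) ≤ suc v) → q ≤ v + k
    q≤v+k right with q ℕ.≤? k
    ... | yes q≤k = ℕ.≤-trans q≤k (ℕ.m≤n+m k v)
    ... | no q≰k  = ℕ.≤-pred (subst (suc q ≤_) (ℕ.+-suc v k)
                      (∸≤⇒≤+ (suc q) (suc k) v (ℕ.≤-pred (right (s≤s (ℕ.≰⇒> q≰k))))))
    v≤q+m : (suc q ≤ suc k → suc v ≤ suc k + suc q) → v ≤ q + suc k
    v≤q+m left with q ℕ.≤? k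
    ... | yes q≤k = ℕ.≤-pred (subst (suc v ≤_) (+-suc-comm (suc k) q) (left (s≤s q≤k)))
    ... | no q≰k  = ℕ.≤-trans v≤ (ℕ.+-monoˡ-≤ (suc k) (ℕ.<⇒≤ (ℕ.≰⇒> q≰k)))

  within-even-pos : Within k (suc k) q v ⇔
    ((suc v ≤ suc k → suc q ≤ suc k + suc v ∸ 1) × (suc (suc k) ≤ suc v → suc v ∸ suc k ≤ suc q))
  within-even-pos = mk⇔
    (λ (q≤v+k , v≤q+m) → (λ _ → subst (suc q ≤_) (sym (+-suc-comm k v)) (s≤s q≤v+k)) ,
                         (λ _ → ≤+⇒∸≤ (suc v) (suc k) (suc q) (s≤s v≤q+m)))
    (λ (left , right) → q≤v+k left , v≤q+m right)
    where
    q≤v+k : (suc v ≤ suc k → suc q ≤ suc k + suc v ∸ 1) → q ≤ v + k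
    q≤v+k left with v ℕ.≤? k
    ... | yes v≤k = ℕ.≤-pred (subst (suc q ≤_) (+-suc-comm k v) (left (s≤s v≤k)))
    ... | no v≰k  = ℕ.≤-trans q≤ (subst (k + suc k ≤_) (ℕ.+-comm k v) (ℕ.+-monoʳ-≤ k (ℕ.≰⇒> v≰k)))
    v≤q+m : (suc (suc k) ≤ suc v → suc v ∸ suc k ≤ suc q) → v ≤ q + suc k
    v≤q+m right with v ℕ.≤? k
    ... | yes v≤k = ℕ.≤-trans v≤k (ℕ.≤-trans (ℕ.n≤1+n k) (ℕ.m≤n+m (suc k) q))
    ... | no v≰k  = ℕ.≤-pred (∸≤⇒≤+ (suc v) (suc k) (suc q) (right (s≤s (ℕ.≰⇒> v≰k))))

∀-⇔ : {A B : Fin n → Set} → (∀ j → A j ⇔ B j) → (∀ j → A j) ⇔ (∀ j → B j)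
∀-⇔ A⇔B = mk⇔ (λ a j → Equivalence.to (A⇔B j) (a j)) (λ b j → Equivalence.from (A⇔B j) (b j))

permute-⇔ : (π : Permutation′ n) (P : ℕ → ℕ → Set) →
            (∀ q → P (toℕ q) (toℕ (π ⟨$⟩ʳ q))) ⇔ (∀ j → P (toℕ (π ⟨$⟩ˡ j)) (toℕ j))
permute-⇔ π P = mk⇔
  (λ h j → subst (P _ ∘ toℕ) (inverseʳ π) (h (π ⟨$⟩ˡ j)))
  (λ h q → subst (λ i → P (toℕ i) _) (inverseˡ π) (h (π ⟨$⟩ʳ q)))

twice : ∀ m → m + m ≡ m * 2
twice m = sym (trans (ℕ.*-comm m 2) (cong (_+_ m) (ℕ.+-identityʳ m)))

half-even : ∀ m → (m + m) / 2 ≡ m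
half-even m = trans (cong (_/ 2) (twice m)) (ℕ.m*n/n≡m m 2)

half-odd : ∀ k → (k + suc k) / 2 ≡ k
half-odd k = begin
  (k + suc k) / 2     ≡⟨ cong (_/ 2) (trans (+-suc-comm k k) (cong suc (twice k))) ⟩
  (1 + k * 2) / 2     ≡⟨ ℕ.+-distrib-/-∣ʳ 1 {d = 2} (n∣m*n k) ⟩
  1 / 2 + k * 2 / 2   ≡⟨ ℕ.m*n/n≡m k 2 ⟩
  k                   ∎
  where open ≡-Reasoning

toppleable-odd : ∀ m (π : Permutation′ (suc (m + m))) → Toppleable π (rOdd m) ⇔ Displacement m m π
toppleable-odd m π = Initial.toppleable⇔displacement {m} {m} π (rOdd m) (Fin.toℕ-fromℕ< _) (half-even m)

toppleable-even : ∀ k (π : Permutation′ (suc k + suc k)) →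
                  Toppleable π (rEven (suc k)) ⇔ Displacement k (suc k) π
toppleable-even k π = Initial.toppleable⇔displacement {k} {suc k} π (rEven (suc k))
  (Fin.toℕ-fromℕ< (s≤s (ℕ.m≤m+n (suc k) (suc k)))) (half-odd k)

odd-by-value : ∀ m (π : Permutation′ (suc (m + m))) → Toppleable π (rOdd m) ⇔
  (∀ j → (suc (toℕ j) ≤ m → val π j ≤ m + suc (toℕ j))
       × (suc m ≤ suc (toℕ j) → suc (toℕ j) ∸ m ≤ val π j))
odd-by-value m π = ⇔-trans (toppleable-odd m π)
  (∀-⇔ λ q → within-odd-val (Fin.toℕ≤pred[n] q) (Fin.toℕ≤pred[n] (π ⟨$⟩ʳ q)))

odd-by-position : ∀ m (π : Permutation′ (suc (m + m))) → Toppleable π (rOdd m) ⇔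
  (∀ j → (suc (toℕ j) ≤ suc m → pos π j ≤ m + suc (toℕ j))
       × (suc (suc m) ≤ suc (toℕ j) → suc (toℕ j) ∸ m ≤ pos π j))
odd-by-position m π = ⇔-trans (toppleable-odd m π) (⇔-trans (permute-⇔ π (Within m m))
  (∀-⇔ λ j → within-odd-pos (Fin.toℕ≤pred[n] (π ⟨$⟩ˡ j)) (Fin.toℕ≤pred[n] j)))

even-by-value : ∀ k (π : Permutation′ (suc k + suc k)) → let m = suc k in Toppleable π (rEven m) ⇔
  (∀ j → (suc (toℕ j) ≤ m → val π j ≤ m + suc (toℕ j))
       × (suc m ≤ suc (toℕ j) → suc (suc (toℕ j) ∸ m) ≤ val π j))
even-by-value k π = ⇔-trans (toppleable-even k π)
  (∀-⇔ λ q → within-even-val (Fin.toℕ≤pred[n] q) (Fin.toℕ≤pred[n] (π ⟨$⟩ʳ q)))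

even-by-position : ∀ k (π : Permutation′ (suc k + suc k)) → let m = suc k in Toppleable π (rEven m) ⇔
  (∀ j → (suc (toℕ j) ≤ m → pos π j ≤ m + suc (toℕ j) ∸ 1)
       × (suc m ≤ suc (toℕ j) → suc (toℕ j) ∸ m ≤ pos π j))
even-by-position k π = ⇔-trans (toppleable-even k π) (⇔-trans (permute-⇔ π (Within k (suc k)))
  (∀-⇔ λ j → within-even-pos (Fin.toℕ≤pred[n] (π ⟨$⟩ˡ j)) (Fin.toℕ≤pred[n] j)))

theorem3p4 : (m : ℕ) → 1 ≤ m →
    ((π : Permutation′ (suc (m + m))) →
      ((Toppleable π (rOdd m) ⇔
         (∀ j → (suc (toℕ j) ≤ m → val π j ≤ m + suc (toℕ j))
              × (suc m ≤ suc (toℕ j) → suc (toℕ j) ∸ m ≤ val π j)))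
      × (Toppleable π (rOdd m) ⇔
         (∀ j → (suc (toℕ j) ≤ suc m → pos π j ≤ m + suc (toℕ j))
              × (suc (suc m) ≤ suc (toℕ j) → suc (toℕ j) ∸ m ≤ pos π j)))))
    × ((π : Permutation′ (m + m)) →
      ((Toppleable π (rEven m) ⇔
         (∀ j → (suc (toℕ j) ≤ m → val π j ≤ m + suc (toℕ j))
              × (suc m ≤ suc (toℕ j) → suc (suc (toℕ j) ∸ m) ≤ val π j)))
      × (Toppleable π (rEven m) ⇔
         (∀ j → (suc (toℕ j) ≤ m → pos π j ≤ m + suc (toℕ j) ∸ 1)
              × (suc m ≤ suc (toℕ j) → suc (toℕ j) ∸ m ≤ pos π j)))))
theorem3p4 (suc k) _ =
  (λ π → odd-by-value (suc k) π , odd-by-position (suc k) π) ,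
  (λ π → even-by-value k π , even-by-position k π)
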